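{- For every finite tree $T$ there is a subdivision $T'$ of $T$ with $i_{1,1}(T')\le 2$.
   Context: Discrete-time immunization model with $r=s=1$. For a finite graph $H$, a protocol is a finite sequence $(A_1,\dots,A_N)$ of subsets of $V(H)$ (vertices immunized at time-step $t$); its width is $\max_i|A_i|$. At time $0$ all vertices are red. For $t\ge1$ each vertex is green, yellow or red at time $t$: if $v\in A_t$ then $v$ is green; otherwise, a vertex red or yellow at time $t-1$ is red at time $t$, and a vertex green at time $t-1$ becomes yellow at time $t$ if it has a neighbor that is red at time $t$, and stays green otherwise. The protocol clears $H$ if all vertices are green at time $N$. $i_{1,1}(H)$ is the minimum width of a protocol that clears $H$. A subdivision of a graph is obtained by replacing edges by paths (with new internal vertices). -}

module Defs where

open import Data.Nat using (ℕ; _≤_)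
open import Data.Bool using (Bool; true; false; _∧_; not)
open import Data.Fin using (Fin) renaming (_<_ to _<ᶠ_)
open import Data.Fin.Subset using (Subset; ∣_∣)
open import Data.Vec using (lookup; replicate)
open import Data.List using (List; []; _∷_; _++_; _∷ʳ_; length; foldl; allFin)
open import Data.Bool.ListAction using (any)
open import Data.List.Relation.Unary.All using (All)
open import Data.List.Relation.Unary.Linked using (Linked)
open import Data.List.Relation.Unary.Unique.Propositional using (Unique)
open import Data.List.Membership.Propositional using (_∈_)
open import Data.Product using (Σ; ∃; _×_)
open import Data.Sum using (_⊎_)
open import Relation.Nullary using (¬_)
open import Relation.Binary.PropositionalEquality using (_≡_; _≢_)

record Graph : Set where
  field
    n      : ℕ
    adj    : Fin n → Fin n → Bool
    sym    : ∀ u v → adj u v ≡ adj v u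
    irrefl : ∀ v → adj v v ≡ false
open Graph public

Adj : (G : Graph) → Fin (n G) → Fin (n G) → Set
Adj G u v = adj G u v ≡ true

Connected : Graph → Set
Connected G = ∀ u v → u ≡ v ⊎ ∃ λ (l : List (Fin (n G))) → Linked (Adj G) (u ∷ l ∷ʳ v)

Cycle : Graph → Set
Cycle G = Σ (Fin (n G)) λ x → Σ (List (Fin (n G))) λ rest →
  (2 ≤ length rest) × Unique (x ∷ rest) × Linked (Adj G) (x ∷ rest ∷ʳ x)

Acyclic : Graph → Set
Acyclic G = ¬ Cycle G

IsTree : Graph → Set
IsTree G = Connected G × Acyclic G

Consecutive : {A : Set} → A → A → List A → Set
Consecutive {A} x y l = ∃ λ (l₁ : List A) → ∃ λ (l₂ : List A) →
  (l ≡ l₁ ++ x ∷ y ∷ l₂) ⊎ (l ≡ l₁ ++ y ∷ x ∷ l₂)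

-- H is a subdivision of G: the branch vertices φ(V(G)), and each edge uv of G
-- (listed once, with u < v) is replaced by a path φ u, P u v, φ v in H whose
-- internal vertices P u v are new and private to that edge; every vertex and
-- every edge of H arises in this way.
record IsSubdivisionOf (H G : Graph) : Set where
  field
    φ      : Fin (n G) → Fin (n H)
    φ-inj  : ∀ u w → φ u ≡ φ w → u ≡ w
    P      : Fin (n G) → Fin (n G) → List (Fin (n H))
    path-linked : ∀ u v → u <ᶠ v → Adj G u v → Linked (Adj H) (φ u ∷ P u v ∷ʳ φ v)
    path-unique : ∀ u v → u <ᶠ v → Adj G u v → Unique (φ u ∷ P u v ∷ʳ φ v)
    internal-new : ∀ u v → u <ᶠ v → Adj G u v → ∀ x → x ∈ P u v → ∀ w → φ w ≢ x
    internal-disjoint : ∀ u v u′ v′ → u <ᶠ v → Adj G u v → u′ <ᶠ v′ → Adj G u′ v′ →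
      ∀ x → x ∈ P u v → x ∈ P u′ v′ → (u ≡ u′) × (v ≡ v′)
    cover-vertices : ∀ x → (∃ λ w → φ w ≡ x) ⊎
      (∃ λ u → ∃ λ v → (u <ᶠ v) × Adj G u v × x ∈ P u v)
    cover-edges : ∀ x y → Adj H x y →
      ∃ λ u → ∃ λ v → (u <ᶠ v) × Adj G u v × Consecutive x y (φ u ∷ P u v ∷ʳ φ v)

-- Immunization model with r = s = 1

data Colour : Set where
  green yellow red : Colour

State : Graph → Set
State G = Fin (n G) → Colour

isGreen : Colour → Bool
isGreen green = true
isGreen _     = false

-- one time step: A is the set immunized at time t, s the state at time t-1
step : (G : Graph) → State G → Subset (n G) → State G
step G s A v with lookup A v
... | true  = green
... | false with s v
...   | red    = red
...   | yellow = red
...   | green  = if any (λ w → adj G v w ∧ redNow w) (allFin (n G)) then yellow else green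
  where
    open import Data.Bool using (if_then_else_)
    redNow : Fin (n G) → Bool
    redNow w = not (lookup A w) ∧ not (isGreen (s w))

Protocol : Graph → Set
Protocol G = List (Subset (n G))

allRed : (G : Graph) → State G
allRed G _ = red

run : (G : Graph) → Protocol G → State G
run G p = foldl (step G) (allRed G) p

width≤ : (G : Graph) → Protocol G → ℕ → Set
width≤ G p k = All (λ A → ∣ A ∣ ≤ k) p

Clears : (G : Graph) → Protocol G → Set
Clears G p = ∀ v → run G p v ≡ green

i11≤ : Graph → ℕ → Set
i11≤ G k = ∃ λ (p : Protocol G) → width≤ G p k × Clears G p

-- Every nonempty tree is a binary tree in this sense: a single vertex, or two such trees joined
-- by an edge between their roots (delete a leaf, decompose the rest, graft the leaf back).  Such a
-- tree is cleared recursively with at most two immunizations per step once the edge between its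
-- parts a and b is subdivided by as many vertices as the protocol for (the subdivided) a has steps:
-- clear b; sweep the path from b towards a; run the protocol for a, during which the contamination
-- entering the path from the root of a advances at most one vertex per step and so never reaches b;
-- finally sweep the path again while keeping the root of a immunized.

module Submission where

open import Defs
open import Data.Bool using (Bool; true; false; T; _∧_; _∨_; not; if_then_else_)
open import Data.Bool.Properties using (∧-zeroʳ; ∨-comm) renaming (_≟_ to _≟ᵇ_)
open import Data.Bool.ListAction using (any)
open import Data.Empty using (⊥; ⊥-elim)
open import Data.Unit using (⊤; tt)
open import Relation.Nullary using (¬_; yes; no; ¬?; _×-dec_)
open import Relation.Binary using (tri<; tri≈; tri>)
open import Relation.Binary.Construct.Closure.ReflexiveTransitive using (Star; ε; _◅_)
open import Function using (_∘_)
open import Data.Fin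
  using (Fin; zero; suc; toℕ; fromℕ<; punchIn; punchOut; _↑ˡ_; _↑ʳ_; splitAt) renaming (_<_ to _<ᶠ_)
open import Data.Fin.Properties
  using (<-cmp; <-asym; any?; punchOut-injective; punchIn-injective; punchInᵢ≢i; punchIn-punchOut;
         punchOut-punchIn; punchOut-cong; toℕ-injective; toℕ<n; fromℕ<-toℕ; toℕ-fromℕ<; splitAt-↑ˡ;
         splitAt-↑ʳ; splitAt⁻¹-↑ˡ; splitAt⁻¹-↑ʳ) renaming (<⇒≢ to <⇒≢ᶠ; _≟_ to _≟ᶠ_)
open import Data.Fin.Subset using (Subset; ⁅_⁆; _∪_; _∈_; ∣_∣; inside; outside)
open import Data.Fin.Subset.Properties using (x∈⁅x⁆; x∈p∪q⁺; ∣⁅x⁆∣≡1)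
open import Data.List
  using (List; []; _∷_; [_]; _++_; _∷ʳ_; foldl; map; allFin; length; applyUpTo; applyDownFrom)
open import Data.List.Properties
  using (++-assoc; length-++; foldl-++; map-++; map-∘; length-map; applyUpTo-∷ʳ; applyDownFrom-∷ʳ)
open import Data.List.Relation.Unary.All using (All; []; _∷_)
import Data.List.Relation.Unary.All.Properties as All
open import Data.List.Relation.Unary.All.Properties using (¬Any⇒All¬)
open import Data.List.Relation.Unary.Any using (here; there)
open import Data.List.Relation.Unary.Linked as LinkedBase using (Linked; []; [-]; _∷_)
import Data.List.Relation.Unary.Linked.Properties as Linked
open import Data.List.Relation.Unary.Unique.Propositional using (Unique)
open import Data.List.Relation.Unary.AllPairs using ([]; _∷_)
import Data.List.Relation.Unary.Unique.Propositional.Properties as Unique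
open import Data.List.Membership.Propositional using (_∉_) renaming (_∈_ to _∈ₗ_)
import Data.List.Membership.DecPropositional as DecMembership
open import Data.List.Membership.Propositional.Properties
  using (∈-applyUpTo⁻; ∈-applyDownFrom⁻; ∈-applyUpTo⁺; ∈-applyDownFrom⁺; ∈-map⁺; ∈-map⁻; ∈-∃++)
open import Data.Nat using (ℕ; zero; suc; _+_; _≤_; _<_; z≤n; s≤s; _≡ᵇ_; _<?_)
open import Data.Nat.Properties
  using (+-suc; m≤n⇒m≤1+n; ≡ᵇ⇒≡; ≤-pred; m≤n⇒m<n∨m≡n; m<n⇒n≢0; ≤-<-trans; <⇒≤; ≤-reflexive;
         +-identityʳ; m≤m+n; <⇒≱; ≤-refl; <-irrefl; ≤∧≮⇒≡; <⇒≢; <-trans; n≤1+n; n≤0⇒n≡0; ≮⇒≥)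
open import Data.Product using (∃; _×_; _,_; proj₁; proj₂; swap)
open import Data.Product.Properties using (,-injective)
open import Data.Sum using (_⊎_; inj₁; inj₂)
import Data.Sum as Sum
open import Data.Vec using (lookup; []; _∷_)
open import Data.Vec.Properties using ([]=⇒lookup)
open import Relation.Binary.PropositionalEquality as ≡ using (_≡_; _≢_; refl; cong; cong₂; subst)

∧-true⁻ : ∀ a {b} → (a ∧ b) ≡ true → a ≡ true × b ≡ true
∧-true⁻ true b≡true = refl , b≡true

∨-true⁻ : ∀ {a b} → (a ∨ b) ≡ true → a ≡ true ⊎ b ≡ true
∨-true⁻ {true}  _      = inj₁ refl
∨-true⁻ {false} b≡true = inj₂ b≡true

≡ᵇ-true⇒≡ : ∀ {m k} → (m ≡ᵇ k) ≡ true → m ≡ k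
≡ᵇ-true⇒≡ {m} {k} h = ≡ᵇ⇒≡ m k (subst T (≡.sym h) tt)

≡⇒≡ᵇ-true : ∀ {m k} → m ≡ k → (m ≡ᵇ k) ≡ true
≡⇒≡ᵇ-true {zero}  refl = refl
≡⇒≡ᵇ-true {suc m} refl = ≡⇒≡ᵇ-true {m} refl

any-false : ∀ {A : Set} (f : A → Bool) xs → (∀ x → f x ≡ false) → any f xs ≡ false
any-false f []       _ = refl
any-false f (x ∷ xs) h rewrite h x = any-false f xs h

mapBoth : ∀ {A B : Set} → (A → B) → A × A → B × B
mapBoth f (x , y) = f x , f y

module _ {A : Set} where

  Consecutive-∷ : ∀ {x y : A} z l → Consecutive x y l → Consecutive x y (z ∷ l)
  Consecutive-∷ z l (l₁ , l₂ , inj₁ eq) = z ∷ l₁ , l₂ , inj₁ (cong (z ∷_) eq)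
  Consecutive-∷ z l (l₁ , l₂ , inj₂ eq) = z ∷ l₁ , l₂ , inj₂ (cong (z ∷_) eq)

  Consecutive-sym : ∀ {x y : A} {l} → Consecutive x y l → Consecutive y x l
  Consecutive-sym (l₁ , l₂ , inj₁ eq) = l₁ , l₂ , inj₂ eq
  Consecutive-sym (l₁ , l₂ , inj₂ eq) = l₁ , l₂ , inj₁ eq

  Consecutive-map : ∀ {B : Set} (g : A → B) {x y : A} {l} → Consecutive x y l → Consecutive (g x) (g y) (map g l)
  Consecutive-map g (l₁ , l₂ , inj₁ refl) = map g l₁ , map g l₂ , inj₁ (map-++ g l₁ _)
  Consecutive-map g (l₁ , l₂ , inj₂ refl) = map g l₁ , map g l₂ , inj₂ (map-++ g l₁ _)

  applyUpTo-consecutive : ∀ (f : ℕ → A) {i} n → suc i < n → Consecutive (f i) (f (suc i)) (applyUpTo f n)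
  applyUpTo-consecutive f {zero}  (suc (suc n)) _         = [] , applyUpTo (λ k → f (suc (suc k))) n , inj₁ refl
  applyUpTo-consecutive f {zero}  (suc zero)    (s≤s ())
  applyUpTo-consecutive f {suc i} (suc n)       (s≤s i+1<n) =
    Consecutive-∷ (f 0) _ (applyUpTo-consecutive (f ∘ suc) n i+1<n)

  applyDownFrom-consecutive : ∀ (f : ℕ → A) {i} n → suc i < n → Consecutive (f i) (f (suc i)) (applyDownFrom f n)
  applyDownFrom-consecutive f {i} (suc n) i+1<n+1 with m≤n⇒m<n∨m≡n (≤-pred i+1<n+1)
  ... | inj₁ i+1<n = Consecutive-∷ (f n) _ (applyDownFrom-consecutive f n i+1<n)
  ... | inj₂ refl  = [] , applyDownFrom f i , inj₂ refl

  Unique-++⁻ˡ : ∀ (xs : List A) {ys} → Unique (xs ++ ys) → Unique xs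
  Unique-++⁻ˡ []       _          = []
  Unique-++⁻ˡ (x ∷ xs) (x∉ ∷ u) = All.++⁻ˡ xs x∉ ∷ Unique-++⁻ˡ xs u

  module _ {R : A → A → Set} where

    Linked-++⁻ˡ : ∀ (xs : List A) {ys} → Linked R (xs ++ ys) → Linked R xs
    Linked-++⁻ˡ []           _       = []
    Linked-++⁻ˡ (x ∷ [])     _       = [-]
    Linked-++⁻ˡ (x ∷ y ∷ xs) (r ∷ l) = r ∷ Linked-++⁻ˡ (y ∷ xs) l

    Linked-∷ʳ : ∀ (xs : List A) {w a} → Linked R (xs ∷ʳ w) → R w a → Linked R (xs ∷ʳ w ∷ʳ a)
    Linked-∷ʳ []           _       r = r ∷ [-]
    Linked-∷ʳ (x ∷ [])     (r′ ∷ _) r = r′ ∷ r ∷ [-]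
    Linked-∷ʳ (x ∷ y ∷ xs) (r′ ∷ l) r = r′ ∷ Linked-∷ʳ (y ∷ xs) l r

Unique-length≤ : ∀ {m} (xs : List (Fin m)) → Unique xs → length xs ≤ m
Unique-length≤ {zero}  []       _          = z≤n
Unique-length≤ {suc m} []       _          = z≤n
Unique-length≤ {suc m} (i ∷ xs) (i∉xs ∷ u) =
  s≤s (subst (_≤ m) (length-punchOuts xs i∉xs) (Unique-length≤ (punchOuts xs i∉xs) (punchOuts-unique xs i∉xs u)))
  where
  punchOuts : ∀ ys → All (i ≢_) ys → List (Fin m)
  punchOuts []       []         = []
  punchOuts (y ∷ ys) (i≢y ∷ ps) = punchOut i≢y ∷ punchOuts ys ps

  length-punchOuts : ∀ ys (ps : All (i ≢_) ys) → length (punchOuts ys ps) ≡ length ys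
  length-punchOuts []       []       = refl
  length-punchOuts (y ∷ ys) (_ ∷ ps) = cong suc (length-punchOuts ys ps)

  punchOuts-unique : ∀ ys (ps : All (i ≢_) ys) → Unique ys → Unique (punchOuts ys ps)
  punchOuts-unique []       []         _          = []
  punchOuts-unique (y ∷ ys) (i≢y ∷ ps) (y∉ys ∷ u) = fresh ys ps y∉ys ∷ punchOuts-unique ys ps u
    where
    fresh : ∀ zs (qs : All (i ≢_) zs) → All (y ≢_) zs → All (punchOut i≢y ≢_) (punchOuts zs qs)
    fresh []       []         []           = []
    fresh (z ∷ zs) (i≢z ∷ qs) (y≢z ∷ y∉zs) = (λ eq → y≢z (punchOut-injective i≢y i≢z eq)) ∷ fresh zs qs y∉zs

module _ {V : Set} {R : V → V → Set} where

  Linked⇒Star : ∀ u l v → Linked R (u ∷ l ∷ʳ v) → Star R u v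
  Linked⇒Star u []      v (r ∷ _) = r ◅ ε
  Linked⇒Star u (x ∷ l) v (r ∷ rs) = r ◅ Linked⇒Star x l v rs

  Star⇒Linked : ∀ {u v} → Star R u v → u ≡ v ⊎ ∃ λ l → Linked R (u ∷ l ∷ʳ v)
  Star⇒Linked ε = inj₁ refl
  Star⇒Linked (_◅_ {j = y} r rs) with Star⇒Linked rs
  ... | inj₁ refl     = inj₂ ([] , r ∷ [-])
  ... | inj₂ (l , rl) = inj₂ (y ∷ l , r ∷ rl)

step-green : ∀ G (s : State G) (A : Subset (n G)) v →
  v ∈ A ⊎ (s v ≡ green × (∀ w → Adj G v w → w ∈ A ⊎ s w ≡ green)) →
  step G s A v ≡ green
step-green G s A v h with lookup A v in v∈?A
... | true = refl
... | false with h
...   | inj₁ v∈A with () ← ≡.trans (≡.sym ([]=⇒lookup v∈A)) v∈?A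
step-green G s A v h | false | inj₂ (sv , nb) rewrite sv =
  cong (if_then yellow else green) (any-false _ (allFin (n G)) quiet)
  where
  quiet : ∀ w → (adj G v w ∧ (not (lookup A w) ∧ not (isGreen (s w)))) ≡ false
  quiet w with adj G v w in avw
  ... | false = refl
  ... | true with nb w avw
  ...   | inj₁ w∈A rewrite []=⇒lookup w∈A = refl
  ...   | inj₂ sw rewrite sw = ∧-zeroʳ _

record Guarantee (H : Graph) {V : Set} (e : V → Fin (n H)) (X : V → Set) (p : Protocol H) (Y : V → Set) : Set where
  constructor guarantee
  field
    green-after : ∀ (s : State H) → (∀ x → X x → s (e x) ≡ green) →
                  ∀ y → Y y → foldl (step H) s p (e y) ≡ green
open Guarantee public

module _ {H : Graph} {V : Set} {e : V → Fin (n H)} where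

  guarantee-[] : ∀ {X Y} → (∀ v → Y v → X v) → Guarantee H e X [] Y
  guarantee-[] Y⊆X = guarantee λ s hs y hy → hs y (Y⊆X y hy)

  guarantee-++ : ∀ {X Y Z p q} → Guarantee H e X p Y → Guarantee H e Y q Z → Guarantee H e X (p ++ q) Z
  guarantee-++ {p = p} {q} gp gq = guarantee λ s hs z hz →
    subst (_≡ green) (cong (λ t → t (e z)) (≡.sym (foldl-++ (step H) s p q)))
      (green-after gq (foldl (step H) s p) (green-after gp s hs) z hz)

  guarantee-⊎ : ∀ {X X′ Y Y′ p} → Guarantee H e X p Y → Guarantee H e X′ p Y′ →
                Guarantee H e (λ v → X v ⊎ X′ v) p (λ v → Y v ⊎ Y′ v)
  guarantee-⊎ g g′ = guarantee λ where
    s hs y (inj₁ hy) → green-after g  s (λ x hx → hs x (inj₁ hx)) y hy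
    s hs y (inj₂ hy) → green-after g′ s (λ x hx → hs x (inj₂ hx)) y hy

  guarantee-weaken : ∀ {X X′ Y Y′ p} → (∀ v → X v → X′ v) → (∀ v → Y v → Y′ v) →
                     Guarantee H e X p Y′ → Guarantee H e X′ p Y
  guarantee-weaken X⊆X′ Y⊆Y′ g = guarantee λ s hs y hy →
    green-after g s (λ x hx → hs x (X⊆X′ x hx)) y (Y⊆Y′ y hy)

  Protected : Subset (n H) → (V → Set) → V → Set
  Protected A X y = e y ∈ A ⊎ (X y × (∀ w → Adj H (e y) w → w ∈ A ⊎ ∃ λ x → e x ≡ w × X x))

  guarantee-step : ∀ {X Y} (A : Subset (n H)) → (∀ y → Y y → Protected A X y) → Guarantee H e X (A ∷ []) Y
  guarantee-step {X} A protected = guarantee λ s hs y hy → step-green H s A (e y) (green-before s hs (protected y hy))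
    where
    green-before : ∀ s → (∀ x → X x → s (e x) ≡ green) → ∀ {y} → Protected A X y →
      e y ∈ A ⊎ (s (e y) ≡ green × (∀ w → Adj H (e y) w → w ∈ A ⊎ s w ≡ green))
    green-before s hs (inj₁ y∈A) = inj₁ y∈A
    green-before s hs {y} (inj₂ (Xy , nb)) = inj₂ (hs y Xy , nb′)
      where
      nb′ : ∀ w → Adj H (e y) w → w ∈ A ⊎ s w ≡ green
      nb′ w a with nb w a
      ... | inj₁ w∈A = inj₁ w∈A
      ... | inj₂ (x , refl , Xx) = inj₂ (hs x Xx)

guarantee-reindex : ∀ {H : Graph} {V W : Set} {e : W → Fin (n H)} (f : V → W)
  {X : V → Set} {X′ : W → Set} {p} {Y : V → Set} {Y′ : W → Set} →
  (∀ v → X v → X′ (f v)) → (∀ w → Y′ w → ∃ λ v → f v ≡ w × Y v) →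
  Guarantee H (λ v → e (f v)) X p Y → Guarantee H e X′ p Y′
guarantee-reindex {H} {e = e} f {X} {X′} {p} {Y} X⊆X′ Y′⊆fY g = guarantee λ s hs w hw → go s hs (Y′⊆fY w hw)
  where
  go : ∀ s → (∀ w → X′ w → s (e w) ≡ green) →
       ∀ {w} → (∃ λ v → f v ≡ w × Y v) → foldl (step H) s p (e w) ≡ green
  go s hs (v , refl , Yv) = green-after g s (λ x hx → hs (f x) (X⊆X′ x hx)) v Yv

pair : ∀ {m} → Fin m → Fin m → Subset m
pair x y = ⁅ x ⁆ ∪ ⁅ y ⁆

x∈pair : ∀ {m} (x y : Fin m) → x ∈ pair x y
x∈pair x y = x∈p∪q⁺ (inj₁ (x∈⁅x⁆ x))

y∈pair : ∀ {m} (x y : Fin m) → y ∈ pair x y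
y∈pair x y = x∈p∪q⁺ (inj₂ (x∈⁅x⁆ y))

∣p∪q∣≤∣p∣+∣q∣ : ∀ {m} (p q : Subset m) → ∣ p ∪ q ∣ ≤ ∣ p ∣ + ∣ q ∣
∣p∪q∣≤∣p∣+∣q∣ []            []            = z≤n
∣p∪q∣≤∣p∣+∣q∣ (outside ∷ p) (outside ∷ q) = ∣p∪q∣≤∣p∣+∣q∣ p q
∣p∪q∣≤∣p∣+∣q∣ (outside ∷ p) (inside  ∷ q) rewrite +-suc ∣ p ∣ ∣ q ∣ = s≤s (∣p∪q∣≤∣p∣+∣q∣ p q)
∣p∪q∣≤∣p∣+∣q∣ (inside  ∷ p) (outside ∷ q) = s≤s (∣p∪q∣≤∣p∣+∣q∣ p q)
∣p∪q∣≤∣p∣+∣q∣ (inside  ∷ p) (inside  ∷ q) rewrite +-suc ∣ p ∣ ∣ q ∣ = s≤s (m≤n⇒m≤1+n (∣p∪q∣≤∣p∣+∣q∣ p q))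

∣pair∣≤2 : ∀ {m} (x y : Fin m) → ∣ pair x y ∣ ≤ 2
∣pair∣≤2 x y = subst (∣ pair x y ∣ ≤_) (≡.cong₂ _+_ (∣⁅x⁆∣≡1 x) (∣⁅x⁆∣≡1 y)) (∣p∪q∣≤∣p∣+∣q∣ ⁅ x ⁆ ⁅ y ⁆)

-- join L a b consists of a and b with their roots joined by a path through L new vertices.
data Shape : Set where
  leaf : Shape
  join : ℕ → Shape → Shape → Shape

data Vertex : Shape → Set where
  point : Vertex leaf
  left  : ∀ {L a b} → Vertex a → Vertex (join L a b)
  path  : ∀ {L a b} → Fin L → Vertex (join L a b)
  right : ∀ {L a b} → Vertex b → Vertex (join L a b)

left-injective : ∀ {L a b} {u v : Vertex a} → left {L} {a} {b} u ≡ left v → u ≡ v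
left-injective refl = refl

right-injective : ∀ {L a b} {u v : Vertex b} → right {L} {a} {b} u ≡ right v → u ≡ v
right-injective refl = refl

path-injective : ∀ {L a b} {i j : Fin L} → path {L} {a} {b} i ≡ path j → i ≡ j
path-injective refl = refl

root : ∀ s → Vertex s
root leaf         = point
root (join _ a _) = left (root a)

isRoot : ∀ {s} → Vertex s → Bool
isRoot point     = true
isRoot (left x)  = isRoot x
isRoot (path _)  = false
isRoot (right _) = false

isRoot-root : ∀ s → isRoot (root s) ≡ true
isRoot-root leaf         = refl
isRoot-root (join _ a _) = isRoot-root a

isRoot⇒≡root : ∀ {s} (x : Vertex s) → isRoot x ≡ true → x ≡ root s
isRoot⇒≡root point    _ = refl
isRoot⇒≡root (left x) h = cong left (isRoot⇒≡root x h)

consecutiveᵇ : ℕ → ℕ → Bool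
consecutiveᵇ i j = (suc i ≡ᵇ j) ∨ (suc j ≡ᵇ i)

adjacent : ∀ {s} → Vertex s → Vertex s → Bool
adjacent point point = false
adjacent (left x) (left y) = adjacent x y
adjacent (left x) (path j) = isRoot x ∧ (toℕ j ≡ᵇ 0)
adjacent {join L _ _} (left x) (right y) = isRoot x ∧ (isRoot y ∧ (L ≡ᵇ 0))
adjacent (path i) (left y) = isRoot y ∧ (toℕ i ≡ᵇ 0)
adjacent (path i) (path j) = consecutiveᵇ (toℕ i) (toℕ j)
adjacent {join L _ _} (path i) (right y) = isRoot y ∧ (suc (toℕ i) ≡ᵇ L)
adjacent {join L _ _} (right x) (left y) = isRoot y ∧ (isRoot x ∧ (L ≡ᵇ 0))
adjacent {join L _ _} (right x) (path j) = isRoot x ∧ (suc (toℕ j) ≡ᵇ L)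
adjacent (right x) (right y) = adjacent x y

Adjacent : ∀ {s} → Vertex s → Vertex s → Set
Adjacent x y = adjacent x y ≡ true

adjacent-sym : ∀ {s} (x y : Vertex s) → adjacent x y ≡ adjacent y x
adjacent-sym point     point     = refl
adjacent-sym (left x)  (left y)  = adjacent-sym x y
adjacent-sym (left x)  (path j)  = refl
adjacent-sym (left x)  (right y) = refl
adjacent-sym (path i)  (left y)  = refl
adjacent-sym (path i)  (path j)  = ∨-comm (suc (toℕ i) ≡ᵇ toℕ j) _
adjacent-sym (path i)  (right y) = refl
adjacent-sym (right x) (left y)  = refl
adjacent-sym (right x) (path j)  = refl
adjacent-sym (right x) (right y) = adjacent-sym x y

Adjacent-sym : ∀ {s} (x y : Vertex s) → Adjacent x y → Adjacent y x
Adjacent-sym x y = ≡.trans (adjacent-sym y x)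

adjacent-irrefl : ∀ {s} (x : Vertex s) → adjacent x x ≡ false
adjacent-irrefl point     = refl
adjacent-irrefl (left x)  = adjacent-irrefl x
adjacent-irrefl (path i)  = suc≢ᵇ (toℕ i)
  where
  suc≢ᵇ : ∀ k → consecutiveᵇ k k ≡ false
  suc≢ᵇ zero    = refl
  suc≢ᵇ (suc k) = suc≢ᵇ k
adjacent-irrefl (right x) = adjacent-irrefl x

size : Shape → ℕ
size leaf         = 1
size (join L a b) = size a + (L + size b)

encode : ∀ {s} → Vertex s → Fin (size s)
encode point                 = zero
encode {join L a b} (left x)  = encode x ↑ˡ (L + size b)
encode {join L a b} (path j)  = size a ↑ʳ (j ↑ˡ size b)
encode {join L a b} (right y) = size a ↑ʳ (L ↑ʳ encode y)

decode : ∀ {s} → Fin (size s) → Vertex s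
decode {leaf} _ = point
decode {join L a b} x with splitAt (size a) x
... | inj₁ x′ = left (decode x′)
... | inj₂ r with splitAt L r
...   | inj₁ j = path j
...   | inj₂ y = right (decode y)

decode-encode : ∀ {s} (x : Vertex s) → decode (encode x) ≡ x
decode-encode point = refl
decode-encode {join L a b} (left x)
  rewrite splitAt-↑ˡ (size a) (encode x) (L + size b) = cong left (decode-encode x)
decode-encode {join L a b} (path j)
  rewrite splitAt-↑ʳ (size a) (L + size b) (j ↑ˡ size b) | splitAt-↑ˡ L j (size b) = refl
decode-encode {join L a b} (right y)
  rewrite splitAt-↑ʳ (size a) (L + size b) (L ↑ʳ encode y) | splitAt-↑ʳ L (size b) (encode y) =
  cong right (decode-encode y)

encode-decode : ∀ {s} (x : Fin (size s)) → encode {s} (decode x) ≡ x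
encode-decode {leaf} zero = refl
encode-decode {join L a b} x with splitAt (size a) x in eq
... | inj₁ x′ rewrite encode-decode {a} x′ = splitAt⁻¹-↑ˡ eq
... | inj₂ r with splitAt L r in eq′
...   | inj₁ j rewrite splitAt⁻¹-↑ˡ eq′ = splitAt⁻¹-↑ʳ eq
...   | inj₂ y rewrite encode-decode {b} y | splitAt⁻¹-↑ʳ eq′ = splitAt⁻¹-↑ʳ eq

encode-injective : ∀ {s} {x y : Vertex s} → encode x ≡ encode y → x ≡ y
encode-injective {x = x} {y} e = ≡.trans (≡.sym (decode-encode x)) (≡.trans (cong decode e) (decode-encode y))

shapeGraph : Shape → Graph
shapeGraph s = record
  { n      = size s
  ; adj    = λ x y → adjacent (decode {s} x) (decode y)
  ; sym    = λ x y → adjacent-sym (decode {s} x) (decode y)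
  ; irrefl = λ x → adjacent-irrefl (decode {s} x)
  }

shapeGraph-adj : ∀ s (x y : Vertex s) → adj (shapeGraph s) (encode x) (encode y) ≡ adjacent x y
shapeGraph-adj s x y rewrite decode-encode x | decode-encode y = refl

Move : Shape → Set
Move s = Vertex s × Vertex s

diagonal : ∀ {s} → Vertex s → Move s
diagonal v = v , v

movesProtocol : ∀ {s} H → (Vertex s → Fin (n H)) → List (Move s) → Protocol H
movesProtocol H e = map λ (x , y) → pair (e x) (e y)

-- Only the root may have neighbours outside the image, so that a shape can be cleared
-- while it hangs off a larger graph by its root.
record Embedding (s : Shape) (H : Graph) : Set where
  field
    emb        : Vertex s → Fin (n H)
    emb-adj    : ∀ x y → adj H (emb x) (emb y) ≡ adjacent x y
    emb-closed : ∀ x w → isRoot x ≡ false → Adj H (emb x) w → ∃ λ y → emb y ≡ w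
open Embedding

encodeEmbedding : ∀ s → Embedding s (shapeGraph s)
encodeEmbedding s = record
  { emb        = encode
  ; emb-adj    = shapeGraph-adj s
  ; emb-closed = λ _ w _ _ → decode w , encode-decode {s} w
  }

module _ {s H} (E : Embedding s H) where

  emb-neighbour : ∀ {y w} → isRoot y ≡ false → Adj H (emb E y) w → ∃ λ x → emb E x ≡ w × Adjacent y x
  emb-neighbour {y} {w} ny a with emb-closed E y w ny a
  ... | x , refl = x , refl , ≡.trans (≡.sym (emb-adj E y x)) a

  ProtectedIn : Subset (n H) → (Vertex s → Set) → Vertex s → Set
  ProtectedIn A X y = emb E y ∈ A ⊎ (isRoot y ≡ false × X y × (∀ x → Adjacent y x → emb E x ∈ A ⊎ X x))

  guarantee-step-shape : ∀ {X Y : Vertex s → Set} (A : Subset (n H)) →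
    (∀ y → Y y → ProtectedIn A X y) → Guarantee H (emb E) X (A ∷ []) Y
  guarantee-step-shape {X} A protected = guarantee-step A λ y hy → protected⇒Protected (protected y hy)
    where
    protected⇒Protected : ∀ {y} → ProtectedIn A X y → Protected {H = H} {e = emb E} A X y
    protected⇒Protected (inj₁ y∈A) = inj₁ y∈A
    protected⇒Protected {y} (inj₂ (ny , Xy , nb)) = inj₂ (Xy , λ w a → via (emb-neighbour {y} ny a))
      where
      via : ∀ {w} → (∃ λ x → emb E x ≡ w × Adjacent y x) → w ∈ A ⊎ ∃ λ x → emb E x ≡ w × X x
      via (x , refl , yx) with nb x yx
      ... | inj₁ x∈A = inj₁ x∈A
      ... | inj₂ Xx  = inj₂ (x , refl , Xx)

module _ {L : ℕ} {a b : Shape} where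

  OnLeft : Vertex (join L a b) → Set
  OnLeft (left _)  = ⊤
  OnLeft (path _)  = ⊥
  OnLeft (right _) = ⊥

  Beyond : ℕ → Vertex (join L a b) → Set
  Beyond k (left _)  = ⊥
  Beyond k (path j)  = k ≤ toℕ j
  Beyond k (right _) = ⊤

  left-neighbour : ∀ {x z} → isRoot x ≡ false → Adjacent (left {L} {a} {b} x) z → ∃ λ z′ → z ≡ left z′
  left-neighbour {z = left z}  _  _ = z , refl
  left-neighbour {x} {path _}  nx h with () ← ≡.trans (≡.sym nx) (proj₁ (∧-true⁻ (isRoot x) h))
  left-neighbour {x} {right _} nx h with () ← ≡.trans (≡.sym nx) (proj₁ (∧-true⁻ (isRoot x) h))

  right-neighbour : ∀ {y z} → isRoot y ≡ false → Adjacent (right {L} {a} {b} y) z → ∃ λ z′ → z ≡ right z′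
  right-neighbour {z = right z} _ _ = z , refl
  right-neighbour {y} {path _}  ny h with () ← ≡.trans (≡.sym ny) (proj₁ (∧-true⁻ (isRoot y) h))
  right-neighbour {y} {left z}  ny h
    with () ← ≡.trans (≡.sym ny) (proj₁ (∧-true⁻ (isRoot y) (proj₂ (∧-true⁻ (isRoot z) h))))

  pathAt : ∀ {k} → k < L → Vertex (join L a b)
  pathAt k<L = path (fromℕ< k<L)

  at-or-beyond : ∀ {k} (k<L : k < L) (j : Fin L) → k ≤ toℕ j → Beyond (suc k) (path j) ⊎ path j ≡ pathAt k<L
  at-or-beyond k<L j k≤j with m≤n⇒m<n∨m≡n k≤j
  ... | inj₁ k<j = inj₁ k<j
  ... | inj₂ k≡j = inj₂ (cong path (toℕ-injective (≡.trans (≡.sym k≡j) (≡.sym (toℕ-fromℕ< k<L)))))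

  beyond-neighbour : ∀ {k} (k<L : k < L) {y x : Vertex (join L a b)} → Beyond (suc k) y → Adjacent y x →
    Beyond (suc k) x ⊎ x ≡ pathAt k<L
  beyond-neighbour k<L {right _} {right _} _ _ = inj₁ tt
  beyond-neighbour k<L {right y} {path j}  _ h =
    at-or-beyond k<L j (≤-pred (subst (_ <_) (≡.sym (≡ᵇ-true⇒≡ (proj₂ (∧-true⁻ (isRoot y) h)))) k<L))
  beyond-neighbour k<L {right y} {left z}  _ h
    with () ← m<n⇒n≢0 k<L (≡ᵇ-true⇒≡ (proj₂ (∧-true⁻ (isRoot y) (proj₂ (∧-true⁻ (isRoot z) h)))))
  beyond-neighbour k<L {path i}  {right _} _ _ = inj₁ tt
  beyond-neighbour k<L {path i}  {left z}  k<i h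
    with () ← m<n⇒n≢0 (≤-<-trans z≤n k<i) (≡ᵇ-true⇒≡ (proj₂ (∧-true⁻ (isRoot z) h)))
  beyond-neighbour k<L {path i}  {path j}  k<i h with ∨-true⁻ h
  ... | inj₁ i+1≡j = inj₁ (subst (_ ≤_) (≡ᵇ-true⇒≡ i+1≡j) (m≤n⇒m≤1+n k<i))
  ... | inj₂ j+1≡i = at-or-beyond k<L j (≤-pred (subst (_ <_) (≡.sym (≡ᵇ-true⇒≡ j+1≡i)) k<i))

  descending : ∀ k → k ≤ L → List (Vertex (join L a b))
  descending zero    _   = []
  descending (suc k) k<L = pathAt k<L ∷ descending k (<⇒≤ k<L)

  Beyond-suc⇒Beyond : ∀ {k} (v : Vertex (join L a b)) → Beyond (suc k) v → Beyond k v
  Beyond-suc⇒Beyond (path _)  k<j = <⇒≤ k<j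
  Beyond-suc⇒Beyond (right _) _   = tt

  module _ {H : Graph} (E : Embedding (join L a b) H) where

    leftEmbedding : Embedding a H
    leftEmbedding = record
      { emb        = λ x → emb E (left x)
      ; emb-adj    = λ x y → emb-adj E (left x) (left y)
      ; emb-closed = closed
      }
      where
      closed : ∀ x w → isRoot x ≡ false → Adj H (emb E (left x)) w → ∃ λ y → emb E (left y) ≡ w
      closed x w nx h with emb-neighbour E nx h
      ... | z , refl , xz with left-neighbour {z = z} nx xz
      ...   | z′ , refl = z′ , refl

    rightEmbedding : Embedding b H
    rightEmbedding = record
      { emb        = λ y → emb E (right y)
      ; emb-adj    = λ x y → emb-adj E (right x) (right y)
      ; emb-closed = closed
      }
      where
      closed : ∀ y w → isRoot y ≡ false → Adj H (emb E (right y)) w → ∃ λ z → emb E (right z) ≡ w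
      closed y w ny h with emb-neighbour E refl h
      ... | z , refl , yz with right-neighbour {z = z} ny yz
      ...   | z′ , refl = z′ , refl

    sweep-step : ∀ {k} (k<L : k < L) A → emb E (pathAt k<L) ∈ A →
                 Guarantee H (emb E) (Beyond (suc k)) (A ∷ []) (Beyond k)
    sweep-step {k} k<L A hit = guarantee-step-shape E A go
      where
      guarded : ∀ {y} → Beyond (suc k) y → ∀ x → Adjacent y x → emb E x ∈ A ⊎ Beyond (suc k) x
      guarded by x yx with beyond-neighbour k<L by yx
      ... | inj₁ bx   = inj₂ bx
      ... | inj₂ refl = inj₁ hit
      go : ∀ y → Beyond k y → ProtectedIn E A (Beyond (suc k)) y
      go (path j)  k≤j with at-or-beyond k<L j k≤j
      ... | inj₁ by   = inj₂ (refl , by , guarded by)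
      ... | inj₂ refl = inj₁ hit
      go (right y) _ = inj₂ (refl , tt , guarded {right y} tt)

    -- Whatever is immunized, contamination advances at most one path vertex per step.
    erosion-step : ∀ {k} (k<L : k < L) A → Guarantee H (emb E) (Beyond k) (A ∷ []) (Beyond (suc k))
    erosion-step {k} k<L A = guarantee-step-shape E A go
      where
      go : ∀ y → Beyond (suc k) y → ProtectedIn E A (Beyond k) y
      go y by = inj₂ (nonroot y by , Beyond-suc⇒Beyond y by , λ x yx → inj₂ (kept x (beyond-neighbour k<L by yx)))
        where
        nonroot : ∀ y → Beyond (suc k) y → isRoot y ≡ false
        nonroot (path _)  _ = refl
        nonroot (right _) _ = refl
        kept : ∀ x → Beyond (suc k) x ⊎ x ≡ pathAt k<L → Beyond k x
        kept x (inj₁ bx)   = Beyond-suc⇒Beyond x bx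
        kept x (inj₂ refl) = ≤-reflexive (≡.sym (toℕ-fromℕ< k<L))

    hold-left : ∀ A → emb E (left (root a)) ∈ A → Guarantee H (emb E) OnLeft (A ∷ []) OnLeft
    hold-left A hit = guarantee-step-shape E A go
      where
      go : ∀ y → OnLeft y → ProtectedIn E A OnLeft y
      go (left x) _ with isRoot x in rx
      ... | true rewrite isRoot⇒≡root x rx = inj₁ hit
      ... | false = inj₂ (refl , tt , λ z xz → inj₂ (onLeft (left-neighbour {z = z} rx xz)))
        where
        onLeft : ∀ {z} → (∃ λ z′ → z ≡ left z′) → OnLeft z
        onLeft (_ , refl) = tt

    sweep : ∀ k (k≤L : k ≤ L) →
      Guarantee H (emb E) (Beyond k) (movesProtocol H (emb E) (map diagonal (descending k k≤L))) (Beyond 0)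
    sweep zero    _   = guarantee-[] λ _ b → b
    sweep (suc k) k<L = guarantee-++
      (sweep-step k<L _ (x∈pair _ _)) (sweep k (<⇒≤ k<L))

    cleanup : ∀ k (k≤L : k ≤ L) →
      Guarantee H (emb E) (λ v → OnLeft v ⊎ Beyond k v)
        (movesProtocol H (emb E) (map (left (root a) ,_) (descending k k≤L))) (λ v → OnLeft v ⊎ Beyond 0 v)
    cleanup zero    _   = guarantee-[] λ _ h → h
    cleanup (suc k) k<L = guarantee-++
      (guarantee-⊎ (hold-left _ (x∈pair _ _)) (sweep-step k<L _ (y∈pair _ _))) (cleanup k (<⇒≤ k<L))

    erosion : ∀ k (q : Protocol H) → k + length q ≤ L → Guarantee H (emb E) (Beyond k) q (Beyond (k + length q))
    erosion k []      _ rewrite +-identityʳ k = guarantee-[] λ _ b → b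
    erosion k (A ∷ q) k+q<L rewrite +-suc k (length q) =
      guarantee-++ (erosion-step (≤-<-trans (m≤m+n k (length q)) k+q<L) A) (erosion (suc k) q k+q<L)

module _ {s : Shape} {H : Graph} {e : Vertex s → Fin (n H)} where

  guarantee-moves-++ : ∀ {X Y Z} (xs ys : List (Move s)) →
    Guarantee H e X (movesProtocol H e xs) Y → Guarantee H e Y (movesProtocol H e ys) Z →
    Guarantee H e X (movesProtocol H e (xs ++ ys)) Z
  guarantee-moves-++ {X} {Z = Z} xs ys gx gy =
    subst (λ p → Guarantee H e X p Z) (≡.sym (map-++ _ xs ys)) (guarantee-++ gx gy)

guarantee-mapBoth : ∀ {s t H} {e : Vertex t → Fin (n H)} {X Y} (f : Vertex s → Vertex t) (ms : List (Move s)) →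
  Guarantee H e X (movesProtocol H (λ v → e (f v)) ms) Y → Guarantee H e X (movesProtocol H e (map (mapBoth f) ms)) Y
guarantee-mapBoth {H = H} {e} {X} {Y} f ms = subst (λ p → Guarantee H e X p Y) (map-∘ ms)

ClearedBy : (s : Shape) → List (Move s) → Set
ClearedBy s ms = ∀ H (E : Embedding s H) → Guarantee H (emb E) (λ _ → ⊥) (movesProtocol H (emb E) ms) (λ _ → ⊤)

record Plan : Set where
  constructor mkPlan
  field
    shape : Shape
    moves : List (Move shape)
open Plan

Sound : Plan → Set
Sound P = ClearedBy (shape P) (moves P)

joinPlan : Plan → Plan → Plan
joinPlan (mkPlan sa ma) (mkPlan sb mb) = mkPlan (join L sa sb)
  (map (mapBoth right) mb ++ map diagonal (descending L ≤-refl) ++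
   map (mapBoth left) ma ++ map (left (root sa) ,_) (descending L ≤-refl))
  where L = length ma

joinPlan-sound : ∀ P Q → Sound P → Sound Q → Sound (joinPlan P Q)
joinPlan-sound (mkPlan sa ma) (mkPlan sb mb) clearsA clearsB H E =
  guarantee-moves-++ (map (mapBoth right) mb) _ clears-b
    (guarantee-moves-++ (map diagonal (descending L ≤-refl)) _ (sweep E L ≤-refl)
      (guarantee-moves-++ (map (mapBoth left) ma) _ clears-a
        (guarantee-weaken (λ _ h → h) everywhere (cleanup E L ≤-refl))))
  where
  L : ℕ
  L = length ma
  e : Vertex (join L sa sb) → Fin (n H)
  e = emb E

  clears-b : Guarantee H e (λ _ → ⊥) (movesProtocol H e (map (mapBoth right) mb)) (Beyond L)
  clears-b = guarantee-mapBoth right mb (guarantee-reindex right (λ _ ()) onRight (clearsB H (rightEmbedding E)))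
    where
    onRight : ∀ v → Beyond L v → ∃ λ y → right y ≡ v × ⊤
    onRight (path j)  L≤j with () ← <⇒≱ (toℕ<n j) L≤j
    onRight (right y) _ = y , refl , tt

  clears-a : Guarantee H e (Beyond 0) (movesProtocol H e (map (mapBoth left) ma)) (λ v → OnLeft v ⊎ Beyond L v)
  clears-a = guarantee-mapBoth left ma (guarantee-weaken (λ { _ (inj₂ b) → b ; _ (inj₁ ()) }) (λ _ h → h)
    (guarantee-⊎ {X = λ _ → ⊥} (guarantee-reindex left (λ _ ()) onLeft (clearsA H (leftEmbedding E))) eroded))
    where
    pa : Protocol H
    pa = movesProtocol H (emb (leftEmbedding E)) ma
    onLeft : ∀ v → OnLeft v → ∃ λ x → left x ≡ v × ⊤
    onLeft (left x) _ = x , refl , tt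
    eroded : Guarantee H e (Beyond 0) pa (Beyond L)
    eroded = subst (λ k → Guarantee H e (Beyond 0) pa (Beyond k)) (length-map _ ma)
      (erosion E 0 pa (≤-reflexive (length-map _ ma)))

  everywhere : ∀ v → ⊤ → OnLeft v ⊎ Beyond 0 v
  everywhere (left _)  _ = inj₁ tt
  everywhere (path _)  _ = inj₂ z≤n
  everywhere (right _) _ = inj₂ tt

-- node a b joins a and b by an edge between their roots; its root is the root of a.
data BTree : Set where
  tip  : BTree
  node : BTree → BTree → BTree

plan : BTree → Plan
plan tip        = mkPlan leaf (diagonal point ∷ [])
plan (node a b) = joinPlan (plan a) (plan b)

plan-sound : ∀ t → Sound (plan t)
plan-sound tip H E = guarantee-step-shape E _ λ { point _ → inj₁ (x∈pair _ _) }
plan-sound (node a b) = joinPlan-sound (plan a) (plan b) (plan-sound a) (plan-sound b)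

movesProtocol-width : ∀ {s} H (e : Vertex s → Fin (n H)) ms → width≤ H (movesProtocol H e ms) 2
movesProtocol-width H e []            = []
movesProtocol-width H e ((x , y) ∷ ms) = ∣pair∣≤2 (e x) (e y) ∷ movesProtocol-width H e ms

sound⇒i11≤2 : ∀ P → Sound P → i11≤ (shapeGraph (shape P)) 2
sound⇒i11≤2 (mkPlan s ms) sound = p , movesProtocol-width H encode ms , clears
  where
  H : Graph
  H = shapeGraph s
  p : Protocol H
  p = movesProtocol H encode ms
  clears : Clears H p
  clears v = subst (λ w → run H p w ≡ green) (encode-decode {s} v)
    (green-after (sound H (encodeEmbedding s)) (allRed H) (λ _ ()) (decode v) tt)

module _ {M : ℕ} {sa sb : Shape} where

  chain : ℕ → Vertex (join M sa sb)
  chain zero = left (root sa)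
  chain (suc i) with i <? M
  ... | yes i<M = path (fromℕ< i<M)
  ... | no  _   = right (root sb)

  chain-path : ∀ {i} (i<M : i < M) → chain (suc i) ≡ path (fromℕ< i<M)
  chain-path {i} i<M with i <? M
  ... | yes _   = refl
  ... | no  i≮M = ⊥-elim (i≮M i<M)

  chain-toℕ : ∀ (j : Fin M) → chain (suc (toℕ j)) ≡ path j
  chain-toℕ j = ≡.trans (chain-path (toℕ<n j)) (cong path (fromℕ<-toℕ j (toℕ<n j)))

  chain-end : chain (suc M) ≡ right (root sb)
  chain-end with M <? M
  ... | yes M<M = ⊥-elim (<-irrefl refl M<M)
  ... | no  _   = refl

  chain-adjacent : ∀ i → i ≤ M → Adjacent (chain i) (chain (suc i))
  chain-adjacent zero _ with 0 <? M
  ... | yes 0<M rewrite isRoot-root sa | toℕ-fromℕ< 0<M = refl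
  ... | no  0≮M rewrite isRoot-root sa | isRoot-root sb = ≡⇒≡ᵇ-true (n≤0⇒n≡0 (≮⇒≥ 0≮M))
  chain-adjacent (suc i) i<M rewrite chain-path i<M with suc i <? M
  ... | yes i+1<M rewrite toℕ-fromℕ< i<M | toℕ-fromℕ< i+1<M = cong (_∨ (suc (suc i) ≡ᵇ i)) (≡⇒≡ᵇ-true {suc i} refl)
  ... | no  i+1≮M rewrite toℕ-fromℕ< i<M | isRoot-root sb = ≡⇒≡ᵇ-true (≤∧≮⇒≡ i<M i+1≮M)

  chain-suc≢left : ∀ i {x} → chain (suc i) ≢ left x
  chain-suc≢left i with i <? M
  ... | yes _ = λ ()
  ... | no  _ = λ ()

  chain-injective : ∀ {i j} → i ≤ suc M → j ≤ suc M → chain i ≡ chain j → i ≡ j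
  chain-injective {zero}  {zero}  _ _ _ = refl
  chain-injective {zero}  {suc j} _ _ eq = ⊥-elim (chain-suc≢left j (≡.sym eq))
  chain-injective {suc i} {zero}  _ _ eq = ⊥-elim (chain-suc≢left i eq)
  chain-injective {suc i} {suc j} i≤M+1 j≤M+1 eq =
    cong suc (inner (m≤n⇒m<n∨m≡n (≤-pred i≤M+1)) (m≤n⇒m<n∨m≡n (≤-pred j≤M+1)) eq)
    where
    inner : i < M ⊎ i ≡ M → j < M ⊎ j ≡ M → chain (suc i) ≡ chain (suc j) → i ≡ j
    inner (inj₁ i<M) (inj₁ j<M) eq rewrite chain-path i<M | chain-path j<M =
      ≡.trans (≡.sym (toℕ-fromℕ< i<M)) (≡.trans (cong toℕ (path-injective eq)) (toℕ-fromℕ< j<M))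
    inner (inj₁ i<M) (inj₂ refl) eq rewrite chain-path i<M | chain-end with () ← eq
    inner (inj₂ refl) (inj₁ j<M) eq rewrite chain-path j<M | chain-end with () ← eq
    inner (inj₂ refl) (inj₂ refl) _ = refl

  chain-linked-up : Linked Adjacent (applyUpTo chain (suc (suc M)))
  chain-linked-up = Linked.applyUpTo⁺₁ chain (suc (suc M)) λ {i} i+1<M+2 → chain-adjacent i (≤-pred (≤-pred i+1<M+2))

  chain-linked-down : Linked Adjacent (applyDownFrom chain (suc (suc M)))
  chain-linked-down = Linked.applyDownFrom⁺₁ chain (suc (suc M)) λ {i} i+1<M+2 →
    Adjacent-sym (chain i) (chain (suc i)) (chain-adjacent i (≤-pred (≤-pred i+1<M+2)))

  chain-unique-up : Unique (applyUpTo chain (suc (suc M)))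
  chain-unique-up = Unique.applyUpTo⁺₁ chain (suc (suc M)) λ i<j j<M+2 eq →
    <⇒≢ i<j (chain-injective (≤-pred (<-trans i<j j<M+2)) (≤-pred j<M+2) eq)

  chain-unique-down : Unique (applyDownFrom chain (suc (suc M)))
  chain-unique-down = Unique.applyDownFrom⁺₁ chain (suc (suc M)) λ j<i i<M+2 eq →
    <⇒≢ j<i (chain-injective (≤-pred (<-trans j<i i<M+2)) (≤-pred i<M+2) (≡.sym eq))

  chain-internal : ∀ {z} → z ∈ₗ applyUpTo (chain ∘ suc) M ⊎ z ∈ₗ applyDownFrom (chain ∘ suc) M →
                   ∃ λ j → z ≡ path j
  chain-internal (inj₁ z∈) with i , i<M , refl ← ∈-applyUpTo⁻ (chain ∘ suc) z∈ = fromℕ< i<M , chain-path i<M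
  chain-internal (inj₂ z∈) with i , i<M , refl ← ∈-applyDownFrom⁻ (chain ∘ suc) z∈ = fromℕ< i<M , chain-path i<M

  OnChain : Vertex (join M sa sb) → Vertex (join M sa sb) → Set
  OnChain p q = ∃ λ i → i ≤ M × p ≡ chain i × q ≡ chain (suc i)

  SameSide : Vertex (join M sa sb) → Vertex (join M sa sb) → Set
  SameSide p q = (∃ λ x → ∃ λ y → p ≡ left x × q ≡ left y) ⊎
                 (∃ λ x → ∃ λ y → p ≡ right x × q ≡ right y)

  EdgeKind : Vertex (join M sa sb) → Vertex (join M sa sb) → Set
  EdgeKind p q = SameSide p q ⊎ OnChain p q ⊎ OnChain q p

  EdgeKind-swap : ∀ {p q} → EdgeKind q p → EdgeKind p q
  EdgeKind-swap (inj₁ (inj₁ (x , y , refl , refl))) = inj₁ (inj₁ (y , x , refl , refl))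
  EdgeKind-swap (inj₁ (inj₂ (x , y , refl , refl))) = inj₁ (inj₂ (y , x , refl , refl))
  EdgeKind-swap (inj₂ (inj₁ c)) = inj₂ (inj₂ c)
  EdgeKind-swap (inj₂ (inj₂ c)) = inj₂ (inj₁ c)

  OnChain-path : ∀ (i j : Fin M) → suc (toℕ i) ≡ toℕ j → OnChain (path i) (path j)
  OnChain-path i j i+1≡j = suc (toℕ i) , subst (_≤ M) (≡.sym i+1≡j) (<⇒≤ (toℕ<n j)) , ≡.sym (chain-toℕ i) ,
    ≡.trans (≡.sym (chain-toℕ j)) (cong (chain ∘ suc) (≡.sym i+1≡j))

  chain-ends : ∀ {x y} → isRoot x ≡ true → isRoot y ≡ true → ∀ {i} → i ≡ M →
               left x ≡ chain 0 × right y ≡ chain (suc i)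
  chain-ends {x} {y} rx ry refl =
    cong left (isRoot⇒≡root x rx) , ≡.trans (cong right (isRoot⇒≡root y ry)) (≡.sym chain-end)

  chain-edge : ∀ {p q} → Adjacent p q → EdgeKind p q
  chain-edge {left x}  {left y}  _ = inj₁ (inj₁ (x , y , refl , refl))
  chain-edge {right x} {right y} _ = inj₁ (inj₂ (x , y , refl , refl))
  chain-edge {left x}  {path j}  h with rx , j≡0 ← ∧-true⁻ (isRoot x) h =
    inj₂ (inj₁ (0 , z≤n , cong left (isRoot⇒≡root x rx) ,
      ≡.trans (≡.sym (chain-toℕ j)) (cong (chain ∘ suc) (≡ᵇ-true⇒≡ j≡0))))
  chain-edge {left x}  {right y} h with rx , ryM ← ∧-true⁻ (isRoot x) h with ry , M≡0 ← ∧-true⁻ (isRoot y) ryM =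
    inj₂ (inj₁ (0 , z≤n , chain-ends rx ry (≡.sym (≡ᵇ-true⇒≡ M≡0))))
  chain-edge {path i}  {right y} h with ry , i+1≡M ← ∧-true⁻ (isRoot y) h =
    inj₂ (inj₁ (suc (toℕ i) , toℕ<n i , ≡.sym (chain-toℕ i) ,
      proj₂ (chain-ends {root sa} (isRoot-root sa) ry (≡ᵇ-true⇒≡ i+1≡M))))
  chain-edge {path i}  {path j}  h with ∨-true⁻ h
  ... | inj₁ i+1≡j = inj₂ (inj₁ (OnChain-path i j (≡ᵇ-true⇒≡ i+1≡j)))
  ... | inj₂ j+1≡i = inj₂ (inj₂ (OnChain-path j i (≡ᵇ-true⇒≡ j+1≡i)))
  chain-edge {path i}  {left y}  h = EdgeKind-swap (chain-edge {left y} {path i} (Adjacent-sym {join M sa sb} (path i) (left y) h))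
  chain-edge {right x} {left y}  h = EdgeKind-swap (chain-edge {left y} {right x} (Adjacent-sym {join M sa sb} (right x) (left y) h))
  chain-edge {right x} {path j}  h = EdgeKind-swap (chain-edge {path j} {right x} (Adjacent-sym {join M sa sb} (right x) (path j) h))

data Node : BTree → Set where
  point : Node tip
  inl   : ∀ {a b} → Node a → Node (node a b)
  inr   : ∀ {a b} → Node b → Node (node a b)

rootNode : ∀ t → Node t
rootNode tip        = point
rootNode (node a _) = inl (rootNode a)

isRootNode : ∀ {t} → Node t → Bool
isRootNode point   = true
isRootNode (inl x) = isRootNode x
isRootNode (inr _) = false

isRootNode-root : ∀ t → isRootNode (rootNode t) ≡ true
isRootNode-root tip        = refl
isRootNode-root (node a _) = isRootNode-root a

isRootNode⇒≡root : ∀ {t} (x : Node t) → isRootNode x ≡ true → x ≡ rootNode t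
isRootNode⇒≡root point   _ = refl
isRootNode⇒≡root (inl x) h = cong inl (isRootNode⇒≡root x h)

adjacentNode : ∀ {t} → Node t → Node t → Bool
adjacentNode point   point   = false
adjacentNode (inl x) (inl y) = adjacentNode x y
adjacentNode (inl x) (inr y) = isRootNode x ∧ isRootNode y
adjacentNode (inr x) (inl y) = isRootNode y ∧ isRootNode x
adjacentNode (inr x) (inr y) = adjacentNode x y

AdjacentNode : ∀ {t} → Node t → Node t → Set
AdjacentNode x y = adjacentNode x y ≡ true

adjacentNode-sym : ∀ {t} (x y : Node t) → adjacentNode x y ≡ adjacentNode y x
adjacentNode-sym point   point   = refl
adjacentNode-sym (inl x) (inl y) = adjacentNode-sym x y
adjacentNode-sym (inl x) (inr y) = refl
adjacentNode-sym (inr x) (inl y) = refl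
adjacentNode-sym (inr x) (inr y) = adjacentNode-sym x y

adjacentNode-irrefl : ∀ {t} (x : Node t) → adjacentNode x x ≡ false
adjacentNode-irrefl point   = refl
adjacentNode-irrefl (inl x) = adjacentNode-irrefl x
adjacentNode-irrefl (inr x) = adjacentNode-irrefl x

AdjacentNode-irrefl : ∀ {t} {x : Node t} → ¬ AdjacentNode x x
AdjacentNode-irrefl {x = x} h with () ← ≡.trans (≡.sym (adjacentNode-irrefl x)) h

AdjacentNode-sym : ∀ {t} (x y : Node t) → AdjacentNode x y → AdjacentNode y x
AdjacentNode-sym x y = ≡.trans (adjacentNode-sym y x)

adjacentNode-roots : ∀ {a b} {x : Node a} {y : Node b} → AdjacentNode (inl x) (inr y) → x ≡ rootNode a × y ≡ rootNode b
adjacentNode-roots {x = x} {y} h with rx , ry ← ∧-true⁻ (isRootNode x) h = isRootNode⇒≡root x rx , isRootNode⇒≡root y ry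

roots-adjacent : ∀ a b → AdjacentNode (inl (rootNode a)) (inr (rootNode b))
roots-adjacent a b rewrite isRootNode-root a | isRootNode-root b = refl

subdivision : BTree → Shape
subdivision t = shape (plan t)

pathLength : BTree → ℕ
pathLength a = length (moves (plan a))

branch : ∀ {t} → Node t → Vertex (subdivision t)
branch point   = point
branch (inl x) = left (branch x)
branch (inr y) = right (branch y)

branch-root : ∀ t → branch (rootNode t) ≡ root (subdivision t)
branch-root tip        = refl
branch-root (node a _) = cong left (branch-root a)

branch-injective : ∀ {t} {x y : Node t} → branch x ≡ branch y → x ≡ y
branch-injective {x = point} {point} _ = refl
branch-injective {x = inl x} {inl y} eq = cong inl (branch-injective (left-injective eq))
branch-injective {x = inr x} {inr y} eq = cong inr (branch-injective (right-injective eq))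

-- The interior of the path replacing the edge x y; junk unless x y is an edge.
internal : ∀ {t} → Node t → Node t → List (Vertex (subdivision t))
internal {tip}      _       _       = []
internal {node a b} (inl x) (inl y) = map left (internal x y)
internal {node a b} (inr x) (inr y) = map right (internal x y)
internal {node a b} (inl _) (inr _) = applyUpTo (chain ∘ suc) (pathLength a)
internal {node a b} (inr _) (inl _) = applyDownFrom (chain ∘ suc) (pathLength a)

route : ∀ {t} → Node t → Node t → List (Vertex (subdivision t))
route x y = branch x ∷ internal x y ∷ʳ branch y

module _ {a b : BTree} where

  route-inl : ∀ (x y : Node a) → route {node a b} (inl x) (inl y) ≡ map left (route x y)
  route-inl x y = cong (left (branch x) ∷_) (≡.sym (map-++ left (internal x y) _))

  route-inr : ∀ (x y : Node b) → route {node a b} (inr x) (inr y) ≡ map right (route x y)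
  route-inr x y = cong (right (branch x) ∷_) (≡.sym (map-++ right (internal x y) _))

  route-up : route {node a b} (inl (rootNode a)) (inr (rootNode b)) ≡ applyUpTo chain (suc (suc (pathLength a)))
  route-up = cong₂ _∷_ (cong left (branch-root a))
    (≡.trans (cong (applyUpTo (chain ∘ suc) (pathLength a) ∷ʳ_) (≡.trans (cong right (branch-root b)) (≡.sym chain-end)))
             (applyUpTo-∷ʳ (chain ∘ suc) (pathLength a)))

  route-down : route {node a b} (inr (rootNode b)) (inl (rootNode a)) ≡ applyDownFrom chain (suc (suc (pathLength a)))
  route-down = ≡.trans
    (cong₂ _∷_ (≡.trans (cong right (branch-root b)) (≡.sym chain-end))
      (cong (applyDownFrom (chain ∘ suc) (pathLength a) ∷ʳ_) (cong left (branch-root a))))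
    (applyDownFrom-∷ʳ chain (suc (pathLength a)))

route-linked : ∀ {t} (x y : Node t) → AdjacentNode x y → Linked Adjacent (route x y)
route-linked point point ()
route-linked {node a b} (inl x) (inl y) h =
  subst (Linked Adjacent) (≡.sym (route-inl {a} {b} x y)) (Linked.map⁺ (route-linked x y h))
route-linked {node a b} (inr x) (inr y) h =
  subst (Linked Adjacent) (≡.sym (route-inr {a} {b} x y)) (Linked.map⁺ (route-linked x y h))
route-linked {node a b} (inl x) (inr y) h with refl , refl ← adjacentNode-roots {x = x} {y} h =
  subst (Linked Adjacent) (≡.sym route-up) chain-linked-up
route-linked {node a b} (inr x) (inl y) h with refl , refl ← adjacentNode-roots {x = y} {x} h =
  subst (Linked Adjacent) (≡.sym route-down) chain-linked-down

route-unique : ∀ {t} (x y : Node t) → AdjacentNode x y → Unique (route x y)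
route-unique point point ()
route-unique {node a b} (inl x) (inl y) h =
  subst Unique (≡.sym (route-inl {a} {b} x y)) (Unique.map⁺ left-injective (route-unique x y h))
route-unique {node a b} (inr x) (inr y) h =
  subst Unique (≡.sym (route-inr {a} {b} x y)) (Unique.map⁺ right-injective (route-unique x y h))
route-unique {node a b} (inl x) (inr y) h with refl , refl ← adjacentNode-roots {x = x} {y} h =
  subst Unique (≡.sym route-up) chain-unique-up
route-unique {node a b} (inr x) (inl y) h with refl , refl ← adjacentNode-roots {x = y} {x} h =
  subst Unique (≡.sym route-down) chain-unique-down

branch≢path : ∀ {a b} (w : Node (node a b)) {j} → branch w ≢ path j
branch≢path (inl _) ()
branch≢path (inr _) ()

internal-not-branch : ∀ {t} (x y : Node t) {z} → z ∈ₗ internal x y → ∀ (w : Node t) → branch w ≢ z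
internal-not-branch {node a b} (inl x) (inl y) z∈ w eq with z′ , z′∈ , refl ← ∈-map⁻ left z∈ with w
... | inl w′ = internal-not-branch x y z′∈ w′ (left-injective eq)
internal-not-branch {node a b} (inr x) (inr y) z∈ w eq with z′ , z′∈ , refl ← ∈-map⁻ right z∈ with w
... | inr w′ = internal-not-branch x y z′∈ w′ (right-injective eq)
internal-not-branch {node a b} (inl x) (inr y) z∈ w eq with j , refl ← chain-internal (inj₁ z∈) = branch≢path w eq
internal-not-branch {node a b} (inr x) (inl y) z∈ w eq with j , refl ← chain-internal (inj₂ z∈) = branch≢path w eq

-- The tree edge whose subdivision path contains the vertex; junk at branch vertices.
owner : ∀ {t} → Vertex (subdivision t) → Node t × Node t
owner {tip}      point     = point , point
owner {node a b} (left z)  = mapBoth inl (owner z)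
owner {node a b} (right z) = mapBoth inr (owner z)
owner {node a b} (path _)  = inl (rootNode a) , inr (rootNode b)

internal-owner : ∀ {t} (x y : Node t) → AdjacentNode x y → ∀ {z} → z ∈ₗ internal x y →
  owner z ≡ (x , y) ⊎ owner z ≡ (y , x)
internal-owner {node a b} (inl x) (inl y) h z∈ with z′ , z′∈ , refl ← ∈-map⁻ left z∈ =
  Sum.map (cong (mapBoth inl)) (cong (mapBoth inl)) (internal-owner x y h z′∈)
internal-owner {node a b} (inr x) (inr y) h z∈ with z′ , z′∈ , refl ← ∈-map⁻ right z∈ =
  Sum.map (cong (mapBoth inr)) (cong (mapBoth inr)) (internal-owner x y h z′∈)
internal-owner {node a b} (inl x) (inr y) h z∈
  with refl , refl ← adjacentNode-roots {x = x} {y} h | j , refl ← chain-internal (inj₁ z∈) = inj₁ refl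
internal-owner {node a b} (inr x) (inl y) h z∈
  with refl , refl ← adjacentNode-roots {x = y} {x} h | j , refl ← chain-internal (inj₂ z∈) = inj₂ refl

internal-disjoint : ∀ {t} {x y x′ y′ : Node t} → AdjacentNode x y → AdjacentNode x′ y′ →
  ∀ {z} → z ∈ₗ internal x y → z ∈ₗ internal x′ y′ → (x ≡ x′ × y ≡ y′) ⊎ (x ≡ y′ × y ≡ x′)
internal-disjoint {x = x} {y} {x′} {y′} h h′ z∈ z∈′ with internal-owner x y h z∈ | internal-owner x′ y′ h′ z∈′
... | inj₁ e | inj₁ e′ = inj₁ (,-injective (≡.trans (≡.sym e) e′))
... | inj₁ e | inj₂ e′ = inj₂ (,-injective (≡.trans (≡.sym e) e′))
... | inj₂ e | inj₁ e′ = inj₂ (swap (,-injective (≡.trans (≡.sym e) e′)))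
... | inj₂ e | inj₂ e′ = inj₁ (swap (,-injective (≡.trans (≡.sym e) e′)))

covered : ∀ {t} (z : Vertex (subdivision t)) →
  (∃ λ (w : Node t) → branch w ≡ z) ⊎
  (∃ λ (x : Node t) → ∃ λ y → AdjacentNode x y × z ∈ₗ internal x y × z ∈ₗ internal y x)
covered {tip} point = inj₁ (point , refl)
covered {node a b} (left z) with covered {a} z
... | inj₁ (w , refl) = inj₁ (inl w , refl)
... | inj₂ (x , y , h , z∈ , z∈′) = inj₂ (inl x , inl y , h , ∈-map⁺ left z∈ , ∈-map⁺ left z∈′)
covered {node a b} (right z) with covered {b} z
... | inj₁ (w , refl) = inj₁ (inr w , refl)
... | inj₂ (x , y , h , z∈ , z∈′) = inj₂ (inr x , inr y , h , ∈-map⁺ right z∈ , ∈-map⁺ right z∈′)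
covered {node a b} (path j) = inj₂ (inl (rootNode a) , inr (rootNode b) , roots-adjacent a b ,
  subst (_∈ₗ applyUpTo (chain ∘ suc) (pathLength a)) (chain-toℕ j) (∈-applyUpTo⁺ (chain ∘ suc) (toℕ<n j)) ,
  subst (_∈ₗ applyDownFrom (chain ∘ suc) (pathLength a)) (chain-toℕ j) (∈-applyDownFrom⁺ (chain ∘ suc) (toℕ<n j)))

EdgeOf : ∀ {t} → Vertex (subdivision t) → Vertex (subdivision t) → Set
EdgeOf {t} p q = ∃ λ (x : Node t) → ∃ λ y → AdjacentNode x y × Consecutive p q (route x y) × Consecutive p q (route y x)

EdgeOf-sym : ∀ {t} {p q : Vertex (subdivision t)} → EdgeOf {t} p q → EdgeOf {t} q p
EdgeOf-sym (x , y , h , c , c′) = x , y , h , Consecutive-sym c , Consecutive-sym c′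

chain-EdgeOf : ∀ {a b} {p q : Vertex (subdivision (node a b))} → OnChain p q → EdgeOf {node a b} p q
chain-EdgeOf {a} {b} (i , i≤M , refl , refl) = inl (rootNode a) , inr (rootNode b) , roots-adjacent a b ,
  subst (Consecutive _ _) (≡.sym route-up) (applyUpTo-consecutive chain _ (s≤s (s≤s i≤M))) ,
  subst (Consecutive _ _) (≡.sym route-down) (applyDownFrom-consecutive chain _ (s≤s (s≤s i≤M)))

edge-covered : ∀ {t} (p q : Vertex (subdivision t)) → Adjacent p q → EdgeOf {t} p q
edge-covered {tip} point point ()
edge-covered {node a b} p q h with chain-edge {p = p} {q} h
... | inj₁ (inj₁ (x , y , refl , refl)) with u , v , huv , c , c′ ← edge-covered {a} x y h =
  inl u , inl v , huv , subst (Consecutive (left x) (left y)) (≡.sym (route-inl {a} {b} u v)) (Consecutive-map left c) ,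
                        subst (Consecutive (left x) (left y)) (≡.sym (route-inl {a} {b} v u)) (Consecutive-map left c′)
... | inj₁ (inj₂ (x , y , refl , refl)) with u , v , huv , c , c′ ← edge-covered {b} x y h =
  inr u , inr v , huv , subst (Consecutive (right x) (right y)) (≡.sym (route-inr {a} {b} u v)) (Consecutive-map right c) ,
                        subst (Consecutive (right x) (right y)) (≡.sym (route-inr {a} {b} v u)) (Consecutive-map right c′)
... | inj₂ (inj₁ on) = chain-EdgeOf {a} {b} on
... | inj₂ (inj₂ on) = EdgeOf-sym {node a b} (chain-EdgeOf {a} {b} on)

subdivision-i11≤2 : ∀ t → i11≤ (shapeGraph (subdivision t)) 2
subdivision-i11≤2 t = sound⇒i11≤2 (plan t) (plan-sound t)

record TreeShaped (T : Graph) : Set where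
  field
    tree            : BTree
    toNode          : Fin (n T) → Node tree
    fromNode        : Node tree → Fin (n T)
    toNode-fromNode : ∀ x → toNode (fromNode x) ≡ x
    fromNode-toNode : ∀ u → fromNode (toNode u) ≡ u
    adj-toNode      : ∀ u v → adj T u v ≡ adjacentNode (toNode u) (toNode v)

module _ {T : Graph} (I : TreeShaped T) where

  private
    open TreeShaped I

    H : Graph
    H = shapeGraph (subdivision tree)

    φ : Fin (n T) → Fin (n H)
    φ u = encode (branch (toNode u))

    P : Fin (n T) → Fin (n T) → List (Fin (n H))
    P u v = map encode (internal (toNode u) (toNode v))

    encode-route : ∀ u v → map encode (route (toNode u) (toNode v)) ≡ φ u ∷ P u v ∷ʳ φ v
    encode-route u v = cong (φ u ∷_) (map-++ encode (internal (toNode u) (toNode v)) _)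

    toNode-injective : ∀ {u v} → toNode u ≡ toNode v → u ≡ v
    toNode-injective {u} {v} eq = ≡.trans (≡.sym (fromNode-toNode u)) (≡.trans (cong fromNode eq) (fromNode-toNode v))

    adjacent-toNode : ∀ {u v} → Adj T u v → AdjacentNode (toNode u) (toNode v)
    adjacent-toNode {u} {v} = ≡.trans (≡.sym (adj-toNode u v))

    adj-fromNode : ∀ {x y} → AdjacentNode x y → Adj T (fromNode x) (fromNode y)
    adj-fromNode {x} {y} h =
      ≡.trans (adj-toNode _ _) (≡.subst₂ AdjacentNode (≡.sym (toNode-fromNode x)) (≡.sym (toNode-fromNode y)) h)

    -- IsSubdivisionOf lists each edge once, as u < v, so tree facts are proved for both orientations.
    orient : ∀ (Q : Node tree → Node tree → Set) {x y} → AdjacentNode x y → Q x y → Q y x →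
             ∃ λ u → ∃ λ v → u <ᶠ v × Adj T u v × Q (toNode u) (toNode v)
    orient Q {x} {y} h qxy qyx with <-cmp (fromNode x) (fromNode y)
    ... | tri< x<y _ _ = fromNode x , fromNode y , x<y , adj-fromNode h ,
      ≡.subst₂ Q (≡.sym (toNode-fromNode x)) (≡.sym (toNode-fromNode y)) qxy
    ... | tri> _ _ y<x = fromNode y , fromNode x , y<x , adj-fromNode (AdjacentNode-sym x y h) ,
      ≡.subst₂ Q (≡.sym (toNode-fromNode y)) (≡.sym (toNode-fromNode x)) qyx
    ... | tri≈ _ x≡y _ = ⊥-elim (AdjacentNode-irrefl {x = x} (subst (AdjacentNode x) (≡.sym (≡.trans (≡.sym (toNode-fromNode x))
      (≡.trans (cong toNode x≡y) (toNode-fromNode y)))) h))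

    path-linked : ∀ u v → u <ᶠ v → Adj T u v → Linked (Adj H) (φ u ∷ P u v ∷ʳ φ v)
    path-linked u v _ h = subst (Linked (Adj H)) (encode-route u v)
      (Linked.map⁺ (LinkedBase.map (λ {x} {y} → ≡.trans (shapeGraph-adj _ x y)) (route-linked _ _ (adjacent-toNode h))))

    path-unique : ∀ u v → u <ᶠ v → Adj T u v → Unique (φ u ∷ P u v ∷ʳ φ v)
    path-unique u v _ h = subst Unique (encode-route u v) (Unique.map⁺ encode-injective (route-unique _ _ (adjacent-toNode h)))

    internal-new : ∀ u v → u <ᶠ v → Adj T u v → ∀ x → x ∈ₗ P u v → ∀ w → φ w ≢ x
    internal-new u v _ _ x x∈ w eq with z , z∈ , refl ← ∈-map⁻ encode x∈ =
      internal-not-branch (toNode u) (toNode v) z∈ (toNode w) (encode-injective eq)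

    paths-disjoint : ∀ u v u′ v′ → u <ᶠ v → Adj T u v → u′ <ᶠ v′ → Adj T u′ v′ →
                         ∀ x → x ∈ₗ P u v → x ∈ₗ P u′ v′ → (u ≡ u′) × (v ≡ v′)
    paths-disjoint u v u′ v′ u<v h u′<v′ h′ x x∈ x∈′
      with z , z∈ , refl ← ∈-map⁻ encode x∈ | z′ , z∈′ , eq ← ∈-map⁻ encode x∈′
      with refl ← encode-injective {x = z} {z′} eq
      with internal-disjoint (adjacent-toNode h) (adjacent-toNode h′) z∈ z∈′
    ... | inj₁ (u≡u′ , v≡v′) = toNode-injective u≡u′ , toNode-injective v≡v′
    ... | inj₂ (u≡v′ , v≡u′) with refl ← toNode-injective u≡v′ | refl ← toNode-injective v≡u′ =
      ⊥-elim (<-asym u<v u′<v′)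

    cover-vertices : ∀ x → (∃ λ w → φ w ≡ x) ⊎ (∃ λ u → ∃ λ v → (u <ᶠ v) × Adj T u v × x ∈ₗ P u v)
    cover-vertices x with covered {tree} (decode x)
    ... | inj₁ (w , eq) = inj₁ (fromNode w ,
      ≡.trans (cong (encode ∘ branch) (toNode-fromNode w)) (≡.trans (cong encode eq) (encode-decode {subdivision tree} x)))
    ... | inj₂ (_ , _ , h , z∈ , z∈′) with u , v , u<v , huv , z∈uv ← orient (λ p q → decode x ∈ₗ internal p q) h z∈ z∈′ =
      inj₂ (u , v , u<v , huv , subst (_∈ₗ P u v) (encode-decode {subdivision tree} x) (∈-map⁺ encode z∈uv))

    cover-edges : ∀ x y → Adj H x y →
      ∃ λ u → ∃ λ v → (u <ᶠ v) × Adj T u v × Consecutive x y (φ u ∷ P u v ∷ʳ φ v)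
    cover-edges x y h with _ , _ , h₀ , c , c′ ← edge-covered (decode x) (decode y) h
      with u , v , u<v , huv , c″ ← orient (λ p q → Consecutive (decode x) (decode y) (route p q)) h₀ c c′ =
      u , v , u<v , huv , subst (Consecutive x y) (encode-route u v)
        (≡.subst₂ (λ p q → Consecutive p q (map encode (route (toNode u) (toNode v))))
          (encode-decode {subdivision tree} x) (encode-decode {subdivision tree} y) (Consecutive-map encode c″))

  treeShaped-subdivision : IsSubdivisionOf (shapeGraph (subdivision tree)) T
  treeShaped-subdivision = record
    { φ                 = φ
    ; φ-inj             = λ u w eq → toNode-injective (branch-injective (encode-injective eq))
    ; P                 = P
    ; path-linked       = path-linked
    ; path-unique       = path-unique
    ; internal-new      = internal-new
    ; internal-disjoint = paths-disjoint
    ; cover-vertices    = cover-vertices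
    ; cover-edges       = cover-edges
    }

isSubdivisionOf-refl : ∀ G → IsSubdivisionOf G G
isSubdivisionOf-refl G = record
  { φ                 = λ u → u
  ; φ-inj             = λ _ _ eq → eq
  ; P                 = λ _ _ → []
  ; path-linked       = λ _ _ _ h → h ∷ [-]
  ; path-unique       = λ _ _ u<v _ → ((<⇒≢ᶠ u<v ∷ []) ∷ [] ∷ [])
  ; internal-new      = λ _ _ _ _ _ ()
  ; internal-disjoint = λ _ _ _ _ _ _ _ _ _ ()
  ; cover-vertices    = λ x → inj₁ (x , refl)
  ; cover-edges       = cover-edges
  }
  where
  cover-edges : ∀ x y → Adj G x y → ∃ λ u → ∃ λ v → (u <ᶠ v) × Adj G u v × Consecutive x y (u ∷ [] ∷ʳ v)
  cover-edges x y h with <-cmp x y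
  ... | tri< x<y _ _ = x , y , x<y , h , [] , [] , inj₁ refl
  ... | tri> _ _ y<x = y , x , y<x , ≡.trans (sym G y x) h , [] , [] , inj₂ refl
  ... | tri≈ _ refl _ with () ← ≡.trans (≡.sym (irrefl G x)) h

module _ (G : Graph) (tree : IsTree G) where

  Leaf : Set
  Leaf = ∃ λ ℓ → ∃ λ u → Adj G ℓ u × ∀ w → Adj G ℓ w → w ≡ u

  private
    V = Fin (n G)
    open DecMembership (_≟ᶠ_ {n G}) using (_∈?_)

    Adj-sym : ∀ {x y} → Adj G x y → Adj G y x
    Adj-sym {x} {y} = ≡.trans (sym G y x)

    Adj-irrefl : ∀ {x} → ¬ Adj G x x
    Adj-irrefl {x} h with () ← ≡.trans (≡.sym (irrefl G x)) h

    record SimplePath : Set where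
      constructor simplePath
      field
        start next : V
        rest       : List V
        unique     : Unique (start ∷ next ∷ rest)
        linked     : Linked (Adj G) (start ∷ next ∷ rest)
    open SimplePath

    vertices : SimplePath → List V
    vertices p = start p ∷ next p ∷ rest p

    -- The chord x w closes the cycle x y r₁ w.
    no-chord : ∀ x y (r₁ r₂ : List V) w → Unique (x ∷ y ∷ (r₁ ++ [ w ] ++ r₂)) →
               Linked (Adj G) (x ∷ y ∷ (r₁ ++ [ w ] ++ r₂)) → ¬ Adj G x w
    no-chord x y r₁ r₂ w u l xw = proj₂ tree (x , y ∷ (r₁ ∷ʳ w) , length≥2 , unique′ , linked′)
      where
      split : x ∷ y ∷ (r₁ ++ [ w ] ++ r₂) ≡ (x ∷ y ∷ (r₁ ∷ʳ w)) ++ r₂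
      split = cong (λ z → x ∷ y ∷ z) (≡.sym (++-assoc r₁ [ w ] r₂))
      length≥2 : 2 ≤ length (y ∷ (r₁ ∷ʳ w))
      length≥2 rewrite length-++ r₁ {[ w ]} | +-suc (length r₁) 0 = s≤s (s≤s z≤n)
      unique′ : Unique (x ∷ y ∷ (r₁ ∷ʳ w))
      unique′ = Unique-++⁻ˡ (x ∷ y ∷ (r₁ ∷ʳ w)) (subst Unique split u)
      linked′ : Linked (Adj G) (x ∷ (y ∷ (r₁ ∷ʳ w)) ∷ʳ x)
      linked′ = Linked-∷ʳ (x ∷ y ∷ r₁)
        (Linked-++⁻ˡ (x ∷ y ∷ (r₁ ∷ʳ w)) (subst (Linked (Adj G)) split l)) (Adj-sym xw)

    extend-or-leaf : (p : SimplePath) → (∃ λ w → Adj G (start p) w × w ∉ vertices p) ⊎ Leaf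
    extend-or-leaf p with any? (λ w → (adj G (start p) w ≟ᵇ true) ×-dec ¬? (w ∈? vertices p))
    ... | yes ext = inj₁ ext
    ... | no ¬ext = inj₂ (start p , next p , first-edge (linked p) , only-next)
      where
      first-edge : ∀ {x y l} → Linked (Adj G) (x ∷ y ∷ l) → Adj G x y
      first-edge (r ∷ _) = r
      only-next : ∀ w → Adj G (start p) w → w ≡ next p
      only-next w sw with w ∈? vertices p
      ... | no  w∉              = ⊥-elim (¬ext (w , sw , w∉))
      ... | yes (here refl)     = ⊥-elim (Adj-irrefl sw)
      ... | yes (there (here e)) = e
      ... | yes (there (there w∈)) with r₁ , r₂ , refl ← ∈-∃++ w∈ =
        ⊥-elim (no-chord _ _ r₁ r₂ w (unique p) (linked p) sw)

    first-step : ∀ {z₁ z₂} l → Linked (Adj G) (z₁ ∷ l ∷ʳ z₂) → ∃ λ c → Adj G z₁ c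
    first-step []      (r ∷ _) = _ , r
    first-step (c ∷ _) (r ∷ _) = c , r

    -- The fuel bounds the number of extensions: a simple path has at most n G vertices.
    longest-path : ∀ fuel (p : SimplePath) → n G < length (vertices p) + fuel → Leaf
    longest-path zero p n<p rewrite +-identityʳ (length (vertices p)) =
      ⊥-elim (<⇒≱ n<p (Unique-length≤ (vertices p) (unique p)))
    longest-path (suc fuel) p n<p+fuel with extend-or-leaf p
    ... | inj₂ found = found
    ... | inj₁ (w , sw , w∉) =
      longest-path fuel
        (simplePath w (start p) (next p ∷ rest p) (¬Any⇒All¬ (vertices p) w∉ ∷ unique p) (Adj-sym sw ∷ linked p))
        (subst (n G <_) (+-suc (length (vertices p)) fuel) n<p+fuel)

  leaf-exists : ∀ (z₁ z₂ : Fin (n G)) → z₁ ≢ z₂ → Leaf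
  leaf-exists z₁ z₂ z₁≢z₂ with proj₁ tree z₁ z₂
  ... | inj₁ z₁≡z₂ = ⊥-elim (z₁≢z₂ z₁≡z₂)
  ... | inj₂ (l , walk) with c , z₁c ← first-step l walk =
    longest-path (n G) (simplePath c z₁ [] (((λ { refl → Adj-irrefl z₁c }) ∷ []) ∷ [] ∷ []) (Adj-sym z₁c ∷ [-]))
      (s≤s (n≤1+n _))

graft : (t : BTree) → Node t → BTree
graft tip        point   = node tip tip
graft (node a b) (inl x) = node (graft a x) b
graft (node a b) (inr y) = node a (graft b y)

old : ∀ {t} (x : Node t) → Node t → Node (graft t x)
old point   point   = inl point
old (inl x) (inl z) = inl (old x z)
old (inl x) (inr z) = inr z
old (inr y) (inl z) = inl z
old (inr y) (inr z) = inr (old y z)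

new : ∀ {t} (x : Node t) → Node (graft t x)
new point   = inr point
new (inl x) = inl (new x)
new (inr y) = inr (new y)

isRootNode-old : ∀ {t} (x z : Node t) → isRootNode (old x z) ≡ isRootNode z
isRootNode-old point   point   = refl
isRootNode-old (inl x) (inl z) = isRootNode-old x z
isRootNode-old (inl x) (inr z) = refl
isRootNode-old (inr y) (inl z) = refl
isRootNode-old (inr y) (inr z) = refl

isRootNode-new : ∀ {t} (x : Node t) → isRootNode (new x) ≡ false
isRootNode-new point   = refl
isRootNode-new (inl x) = isRootNode-new x
isRootNode-new (inr y) = refl

adjacent-old-old : ∀ {t} (x z w : Node t) → adjacentNode (old x z) (old x w) ≡ adjacentNode z w
adjacent-old-old point   point   point   = refl
adjacent-old-old (inl x) (inl z) (inl w) = adjacent-old-old x z w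
adjacent-old-old (inl x) (inl z) (inr w) rewrite isRootNode-old x z = refl
adjacent-old-old (inl x) (inr z) (inl w) rewrite isRootNode-old x w = refl
adjacent-old-old (inl x) (inr z) (inr w) = refl
adjacent-old-old (inr y) (inl z) (inl w) = refl
adjacent-old-old (inr y) (inl z) (inr w) rewrite isRootNode-old y w = refl
adjacent-old-old (inr y) (inr z) (inl w) rewrite isRootNode-old y z = refl
adjacent-old-old (inr y) (inr z) (inr w) = adjacent-old-old y z w

adjacent-old-new : ∀ {t} (x : Node t) → adjacentNode (old x x) (new x) ≡ true
adjacent-old-new point   = refl
adjacent-old-new (inl x) = adjacent-old-new x
adjacent-old-new (inr y) = adjacent-old-new y

adjacent-other-new : ∀ {t} (x z : Node t) → z ≢ x → adjacentNode (old x z) (new x) ≡ false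
adjacent-other-new point   point   z≢x = ⊥-elim (z≢x refl)
adjacent-other-new (inl x) (inl z) z≢x = adjacent-other-new x z (z≢x ∘ cong inl)
adjacent-other-new (inl x) (inr z) _   rewrite isRootNode-new x = refl
adjacent-other-new (inr y) (inl z) _   rewrite isRootNode-new y = ∧-zeroʳ (isRootNode z)
adjacent-other-new (inr y) (inr z) z≢x = adjacent-other-new y z (z≢x ∘ cong inr)

inl-injective : ∀ {a b} {x y : Node a} → inl {a} {b} x ≡ inl y → x ≡ y
inl-injective refl = refl

inr-injective : ∀ {a b} {x y : Node b} → inr {a} {b} x ≡ inr y → x ≡ y
inr-injective refl = refl

old-injective : ∀ {t} (x : Node t) {z w} → old x z ≡ old x w → z ≡ w
old-injective point   {point} {point} _  = refl
old-injective (inl x) {inl z} {inl w} eq = cong inl (old-injective x (inl-injective eq))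
old-injective (inl x) {inr z} {inr w} eq = cong inr (inr-injective eq)
old-injective (inr y) {inl z} {inl w} eq = cong inl (inl-injective eq)
old-injective (inr y) {inr z} {inr w} eq = cong inr (old-injective y (inr-injective eq))
old-injective (inl x) {inl z} {inr w} ()
old-injective (inl x) {inr z} {inl w} ()
old-injective (inr y) {inl z} {inr w} ()
old-injective (inr y) {inr z} {inl w} ()

old≢new : ∀ {t} (x z : Node t) → old x z ≢ new x
old≢new point   point   ()
old≢new (inl x) (inl z) eq = old≢new x z (inl-injective eq)
old≢new (inr y) (inr z) eq = old≢new y z (inr-injective eq)

old-or-new : ∀ {t} (x : Node t) (w : Node (graft t x)) → (∃ λ z → old x z ≡ w) ⊎ w ≡ new x
old-or-new point   (inl point) = inj₁ (point , refl)
old-or-new point   (inr point) = inj₂ refl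
old-or-new (inl x) (inl w) with old-or-new x w
... | inj₁ (z , refl) = inj₁ (inl z , refl)
... | inj₂ refl       = inj₂ refl
old-or-new (inl x) (inr w) = inj₁ (inr w , refl)
old-or-new (inr y) (inl w) = inj₁ (inl w , refl)
old-or-new (inr y) (inr w) with old-or-new y w
... | inj₁ (z , refl) = inj₁ (inr z , refl)
... | inj₂ refl       = inj₂ refl

graphOn : ∀ {m} (a : Fin m → Fin m → Bool) → (∀ u v → a u v ≡ a v u) → (∀ v → a v v ≡ false) → Graph
graphOn a a-sym a-irrefl = record { n = _ ; adj = a ; sym = a-sym ; irrefl = a-irrefl }

module _ {m} (a : Fin (suc m) → Fin (suc m) → Bool) (a-sym : ∀ u v → a u v ≡ a v u) (a-irrefl : ∀ v → a v v ≡ false)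
         (ℓ : Fin (suc m)) where

  deleteVertex : Graph
  deleteVertex = graphOn (λ x y → a (punchIn ℓ x) (punchIn ℓ y))
    (λ x y → a-sym (punchIn ℓ x) _) (λ x → a-irrefl (punchIn ℓ x))

  private
    G = graphOn a a-sym a-irrefl

  deleteLeaf-isTree : IsTree G → ∀ {u₀} → (∀ w → a ℓ w ≡ true → w ≡ u₀) → IsTree deleteVertex
  deleteLeaf-isTree tree {u₀} only-u₀ = connected , acyclic
    where
    -- A walk through the leaf ℓ enters and leaves it via u₀, so that detour can be cut out.
    avoid : ∀ {u v} → Star (Adj G) u v → ∀ x y → punchIn ℓ x ≡ u → punchIn ℓ y ≡ v → Star (Adj deleteVertex) x y
    avoid ε x y refl y≡ = subst (Star _ x) (punchIn-injective ℓ x y (≡.sym y≡)) ε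
    avoid (_◅_ {j = z} r rs) x y refl y≡ with ℓ ≟ᶠ z
    ... | no ℓ≢z =
      subst (Adj G _) (≡.sym (punchIn-punchOut ℓ≢z)) r ◅ avoid rs (punchOut ℓ≢z) y (punchIn-punchOut ℓ≢z) y≡
    ... | yes refl with rs
    ...   | ε       = ⊥-elim (punchInᵢ≢i ℓ y y≡)
    ...   | r′ ◅ rs′ = avoid rs′ x y (≡.trans (only-u₀ _ (≡.trans (a-sym ℓ _) r)) (≡.sym (only-u₀ _ r′))) y≡

    connected : Connected deleteVertex
    connected x y with proj₁ tree (punchIn ℓ x) (punchIn ℓ y)
    ... | inj₁ eq       = inj₁ (punchIn-injective ℓ x y eq)
    ... | inj₂ (l , rl) = Star⇒Linked (avoid (Linked⇒Star _ l _ rl) x y refl refl)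

    acyclic : Acyclic deleteVertex
    acyclic (x , rest , 2≤rest , u , rl) = proj₂ tree (punchIn ℓ x , map (punchIn ℓ) rest ,
      subst (2 ≤_) (≡.sym (length-map _ rest)) 2≤rest ,
      Unique.map⁺ (punchIn-injective ℓ _ _) u ,
      subst (Linked (Adj G)) (cong (punchIn ℓ x ∷_) (map-++ (punchIn ℓ) rest [ x ])) (Linked.map⁺ rl))

  module _ {u₀} (ℓu₀ : a ℓ u₀ ≡ true) (only-u₀ : ∀ w → a ℓ w ≡ true → w ≡ u₀)
           (I : TreeShaped deleteVertex) where
    private
      open TreeShaped I renaming (tree to tree₀; toNode to to₀; fromNode to from₀;
        toNode-fromNode to to-from₀; fromNode-toNode to from-to₀; adj-toNode to adj-to₀)

      ℓ≢u₀ : ℓ ≢ u₀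
      ℓ≢u₀ refl with () ← ≡.trans (≡.sym (a-irrefl ℓ)) ℓu₀

      x₀ : Node tree₀
      x₀ = to₀ (punchOut ℓ≢u₀)

      to : Fin (suc m) → Node (graft tree₀ x₀)
      to v with ℓ ≟ᶠ v
      ... | yes _   = new x₀
      ... | no ℓ≢v = old x₀ (to₀ (punchOut ℓ≢v))

      from : Node (graft tree₀ x₀) → Fin (suc m)
      from w with old-or-new x₀ w
      ... | inj₁ (z , _) = punchIn ℓ (from₀ z)
      ... | inj₂ _       = ℓ

      to-from : ∀ w → to (from w) ≡ w
      to-from w with old-or-new x₀ w
      ... | inj₂ refl with ℓ ≟ᶠ ℓ
      ...   | yes _   = refl
      ...   | no ℓ≢ℓ = ⊥-elim (ℓ≢ℓ refl)
      to-from w | inj₁ (z , refl) with ℓ ≟ᶠ punchIn ℓ (from₀ z)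
      ...   | yes eq    = ⊥-elim (punchInᵢ≢i ℓ (from₀ z) (≡.sym eq))
      ...   | no _ =
        cong (old x₀) (≡.trans (cong to₀ (≡.trans (punchOut-cong ℓ refl) (punchOut-punchIn ℓ))) (to-from₀ z))

      from-to : ∀ v → from (to v) ≡ v
      from-to v with ℓ ≟ᶠ v
      from-to v | yes refl with old-or-new x₀ (new x₀)
      ...   | inj₁ (z , eq) = ⊥-elim (old≢new x₀ z eq)
      ...   | inj₂ _        = refl
      from-to v | no ℓ≢v with old-or-new x₀ (old x₀ (to₀ (punchOut ℓ≢v)))
      ...   | inj₂ eq = ⊥-elim (old≢new x₀ _ eq)
      ...   | inj₁ (z , eq) rewrite old-injective x₀ eq | from-to₀ (punchOut ℓ≢v) = punchIn-punchOut ℓ≢v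

      adj-ℓ : ∀ v (ℓ≢v : ℓ ≢ v) → a ℓ v ≡ adjacentNode (new x₀) (old x₀ (to₀ (punchOut ℓ≢v)))
      adj-ℓ v ℓ≢v rewrite adjacentNode-sym (new x₀) (old x₀ (to₀ (punchOut ℓ≢v))) with v ≟ᶠ u₀
      ... | yes refl rewrite punchOut-cong ℓ {i≢j = ℓ≢v} {i≢k = ℓ≢u₀} refl =
        ≡.trans ℓu₀ (≡.sym (adjacent-old-new x₀))
      ... | no v≢u₀ = ≡.trans not-adjacent (≡.sym (adjacent-other-new x₀ _ (v≢u₀ ∘ toNode-punchOut-injective)))
        where
        not-adjacent : a ℓ v ≡ false
        not-adjacent with a ℓ v in ℓv
        ... | true  = ⊥-elim (v≢u₀ (only-u₀ v ℓv))
        ... | false = refl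
        toNode-punchOut-injective : to₀ (punchOut ℓ≢v) ≡ x₀ → v ≡ u₀
        toNode-punchOut-injective eq = punchOut-injective ℓ≢v ℓ≢u₀
          (≡.trans (≡.sym (from-to₀ _)) (≡.trans (cong from₀ eq) (from-to₀ _)))

      adj-to : ∀ u v → a u v ≡ adjacentNode (to u) (to v)
      adj-to u v with ℓ ≟ᶠ u | ℓ ≟ᶠ v
      ... | yes refl | yes refl = ≡.trans (a-irrefl ℓ) (≡.sym (adjacentNode-irrefl (new x₀)))
      ... | yes refl | no ℓ≢v  = adj-ℓ v ℓ≢v
      ... | no ℓ≢u  | yes refl = ≡.trans (a-sym u ℓ) (≡.trans (adj-ℓ u ℓ≢u) (adjacentNode-sym (new x₀) _))
      ... | no ℓ≢u  | no ℓ≢v  =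
        ≡.trans (cong₂ a (≡.sym (punchIn-punchOut ℓ≢u)) (≡.sym (punchIn-punchOut ℓ≢v)))
          (≡.trans (adj-to₀ (punchOut ℓ≢u) (punchOut ℓ≢v)) (≡.sym (adjacent-old-old x₀ _ _)))

    graftLeaf : TreeShaped G
    graftLeaf = record
      { tree = graft tree₀ x₀ ; toNode = to ; fromNode = from
      ; toNode-fromNode = to-from ; fromNode-toNode = from-to ; adj-toNode = adj-to }

treeShaped : ∀ k (a : Fin (suc k) → Fin (suc k) → Bool) a-sym a-irrefl →
             IsTree (graphOn a a-sym a-irrefl) → TreeShaped (graphOn a a-sym a-irrefl)
treeShaped zero a a-sym a-irrefl _ = record
  { tree = tip ; toNode = λ _ → point ; fromNode = λ _ → zero
  ; toNode-fromNode = λ { point → refl } ; fromNode-toNode = λ { zero → refl }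
  ; adj-toNode = λ { zero zero → a-irrefl zero } }
treeShaped (suc k) a a-sym a-irrefl tree
  with ℓ , u₀ , ℓu₀ , only-u₀ ← leaf-exists (graphOn a a-sym a-irrefl) tree zero (suc zero) (λ ()) =
  graftLeaf a a-sym a-irrefl ℓ ℓu₀ only-u₀
    (treeShaped k _ _ _ (deleteLeaf-isTree a a-sym a-irrefl ℓ tree only-u₀))

corollary5p8 : ∀ (T : Graph) → IsTree T → ∃ λ (T′ : Graph) → IsSubdivisionOf T′ T × i11≤ T′ 2
corollary5p8 T@record { n = zero } _ = T , isSubdivisionOf-refl T , [] , [] , λ ()
corollary5p8 T@record { n = suc k } tree =
  shapeGraph (subdivision (TreeShaped.tree I)) , treeShaped-subdivision I , subdivision-i11≤2 (TreeShaped.tree I)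
  where
  I : TreeShaped T
  I = treeShaped k (adj T) (sym T) (irrefl T) tree
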